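{- We have $$A^{(3)}(x_1,x_2,x_3,\dots)=1+\frac{x_1^2x_2A^{(3)}(x_1,x_2x_3,x_3x_4,\dots)}{1-x_1^2x_2A^{(3)}(x_1,x_2x_3^2x_4,x_3x_4^2x_5,\dots)},$$ and $$B^{(3)}(x_1,x_2,x_3,\dots)=x_1A^{(3)}(x_1,x_2x_3,x_3x_4\dots).$$
   Context: A permutation $\pi$ is a Dumont permutation (of the first kind) if each even integer in $\pi$ is followed by a smaller integer, and each odd integer is either followed by a larger integer or is the last element of $\pi$. Let $\mathcal{D}$ be the set of Dumont permutations of all sizes (including the empty one) avoiding $1\mbox{ - }3\mbox{ - }2$. Generalized patterns: letters separated by dashes may be at any distance, adjacent letters (as $21$ in $21\mbox{ - }3\mbox{ - }\cdots\mbox{ - }j$) must be adjacent in $\pi$. For a pattern $\tau$, $\tau(\pi)$ is its number of occurrences; $1(\pi)$ is the length of $\pi$. Define $\mathcal{C}(x_1,x_2,\dots)=\sum_{\pi\in\mathcal{D}}x_1^{1(\pi)}\prod_{j\geq2}x_j^{21\mbox{ - }3\mbox{ - }\dots\mbox{ - } j(\pi)}$, $A^{(3)}=\frac12(\mathcal{C}(x_1,x_2,\dots)+\mathcal{C}(-x_1,x_2,\dots))$, $B^{(3)}=\frac12(\mathcal{C}(x_1,x_2,\dots)-\mathcal{C}(-x_1,x_2,\dots))$. -}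

module Defs where

open import Data.Nat using (ℕ; zero; suc; _+_; _*_; _∸_; _<ᵇ_; _≡ᵇ_; _%_)
open import Data.Bool using (Bool; true; false; _∧_; _∨_; not; if_then_else_)
open import Data.List using (List; []; _∷_; _++_; map; concatMap; filter; upTo; length; applyUpTo)
open import Data.Bool.ListAction using (any)
open import Data.Product using (_×_)
open import Relation.Binary.PropositionalEquality using (_≡_)
open import Data.List.Relation.Binary.Permutation.Propositional using (_↭_)
open import Relation.Nullary.Decidable using (Dec)
open import Data.Bool.Properties using () renaming (_≟_ to _≟B_)

-- Permutations of [1..n], written as lists of their values π₁ … πₙ.

ins : ℕ → List ℕ → List (List ℕ)
ins a [] = (a ∷ []) ∷ []
ins a (b ∷ l) = (a ∷ b ∷ l) ∷ map (b ∷_) (ins a l)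

perms : ℕ → List (List ℕ)
perms zero = [] ∷ []
perms (suc n) = concatMap (ins (suc n)) (perms n)

isEven : ℕ → Bool
isEven n = n % 2 ≡ᵇ 0

isDumont : List ℕ → Bool
isDumont [] = true
isDumont (a ∷ []) = not (isEven a)
isDumont (a ∷ b ∷ l) =
  (if isEven a then b <ᵇ a else a <ᵇ b) ∧ isDumont (b ∷ l)

has32above : ℕ → List ℕ → Bool
has32above a [] = false
has32above a (b ∷ l) = any (λ c → (a <ᵇ c) ∧ (c <ᵇ b)) l ∨ has32above a l

contains132 : List ℕ → Bool
contains132 [] = false
contains132 (a ∷ l) = has32above a l ∨ contains132 l

avoids132 : List ℕ → Bool
avoids132 π = not (contains132 π)

inD : List ℕ → Bool
inD π = isDumont π ∧ avoids132 π

chains : ℕ → ℕ → List ℕ → ℕ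
chains zero v l = 1
chains (suc k) v [] = 0
chains (suc k) v (a ∷ l) = (if v <ᵇ a then chains k a l else 0) + chains (suc k) v l

-- occ k π = number of occurrences of 21-3-…-(k+2) in π:
-- adjacent πᵢ πᵢ₊₁ with πᵢ₊₁ < πᵢ, followed (anywhere later) by an
-- increasing chain of k entries all larger than πᵢ.
occ : ℕ → List ℕ → ℕ
occ k (a ∷ b ∷ l) = (if b <ᵇ a then chains k a l else 0) + occ k (b ∷ l)
occ k _ = 0

-- Monomials in x₂, x₃, … : exponent lists [e₂, e₃, …]
-- (trailing zeros are irrelevant; see norm).  The exponent of x₁ is
-- recorded separately as the degree index of a series.

Mono : Set
Mono = List ℕ

addM : Mono → Mono → Mono
addM [] m = m
addM (a ∷ m) [] = a ∷ m
addM (a ∷ m) (b ∷ m') = (a + b) ∷ addM m m'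

consN : ℕ → Mono → Mono
consN zero [] = []
consN a m = a ∷ m

norm : Mono → Mono
norm [] = []
norm (a ∷ m) = consN a (norm m)

-- weight of π (exponents of x₂,x₃,…): xⱼ ↦ 21-3-…-j(π); patterns with
-- j > length+1 have no occurrences, so the list [occ 0 π, …] of length
-- |π| captures all of them.
weight : List ℕ → Mono
weight π = applyUpTo (λ k → occ k π) (length π)

-- Formal power series in x₁, x₂, … with nonnegative integer
-- coefficients: S n = the multiset (list) of monomials in x₂,x₃,…
-- occurring with x₁ⁿ, repeated according to coefficient.

Series : Set
Series = ℕ → List Mono

_≈S_ : Series → Series → Set
S ≈S T = ∀ n → map norm (S n) ↭ map norm (T n)

oneS : Series
oneS zero = [] ∷ []
oneS (suc n) = []

_⊕_ : Series → Series → Series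
(S ⊕ T) n = S n ++ T n

mulMonos : List Mono → List Mono → List Mono
mulMonos L L' = concatMap (λ m → map (addM m) L') L

_⊗_ : Series → Series → Series
(S ⊗ T) n = concatMap (λ i → mulMonos (S i) (T (n ∸ i))) (upTo (suc n))

powS : Series → ℕ → Series
powS S zero = oneS
powS S (suc k) = S ⊗ powS S k

-- 1/(1-G) = Σ_k G^k, for G without constant term in x₁ (then G^k has
-- no terms of x₁-degree < k, so k ≤ n suffices in degree n)
geomS : Series → Series
geomS G n = concatMap (λ k → powS G k n) (upTo (suc n))

mulX1 : Series → Series
mulX1 S zero = []
mulX1 S (suc n) = S n

mulX1²X2 : Series → Series
mulX1²X2 S zero = []
mulX1²X2 S (suc zero) = []
mulX1²X2 S (suc (suc n)) = map (addM (1 ∷ [])) (S n)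

substS : (Mono → Mono) → Series → Series
substS f S n = map f (S n)

-- xⱼ ↦ xⱼ xⱼ₊₁ (j ≥ 2): new exponent fₖ = eₖ + eₖ₋₁
σ₁ : Mono → Mono
σ₁ e = addM e (0 ∷ e)

-- xⱼ ↦ xⱼ xⱼ₊₁² xⱼ₊₂ (j ≥ 2): fₖ = eₖ + 2eₖ₋₁ + eₖ₋₂
σ₂ : Mono → Mono
σ₂ e = addM e (addM (0 ∷ map (2 *_) e) (0 ∷ 0 ∷ e))

𝒞 : Series
𝒞 n = map weight (filter (λ π → inD π ≟B true) (perms n))

-- A⁽³⁾ = ½(𝒞(x₁,…)+𝒞(-x₁,…)) = even-in-x₁ part of 𝒞
A3 : Series
A3 n = if isEven n then 𝒞 n else []

-- B⁽³⁾ = ½(𝒞(x₁,…)-𝒞(-x₁,…)) = odd-in-x₁ part of 𝒞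
B3 : Series
B3 n = if isEven n then [] else 𝒞 n

-- A 132-avoiding permutation π of {1, …, n} splits at its maximum as π = α n β with every
-- entry of α above every entry of β.  For odd n the maximum cannot be followed by a larger
-- entry, so π = γ n with γ ∈ 𝒟; appending a new maximum turns every increasing chain of length
-- k into one of length k + 1, which is the substitution σ₁ : xⱼ ↦ xⱼ xⱼ₊₁, and gives B⁽³⁾.
-- For even n the maximum is followed by a smaller entry, and π is either a final block
-- n γ (n-1) or an inner block γ (m-1) m raised above a shorter even-length member of 𝒟;
-- iterating, π is a run of inner blocks on top of a final block.  An inner block appends two
-- new maxima to γ (σ₁ twice, which is σ₂), the descent out of each block contributes x₂, and
-- no occurrence of 21-3-…-j spreads over two blocks, so weights multiply: A⁽³⁾ = 1 + P/(1 - Q).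
-- To compare the multisets of monomials we list these shapes in exactly the order in which the
-- right-hand side lists its monomials, and show that this list and the list of even-length
-- members of 𝒟 are duplicate-free with the same elements.

module Submission where

open import Data.Bool using (Bool; true; false; _∧_; _∨_; not; if_then_else_)
open import Data.Bool.ListAction using (any; all)
open import Data.Bool.Properties using (∧-assoc; ∨-assoc; ∨-zeroʳ; ∧-zeroʳ; ∨-identityʳ; ∧-identityʳ)
  renaming (_≟_ to _≟B_)
open import Data.Empty using (⊥; ⊥-elim)
open import Data.List
  using (List; []; _∷_; _++_; [_]; map; concatMap; filter; upTo; length; applyUpTo; take; drop; last)
open import Data.List.Extrema.Nat using (max; xs≤max; max<v⁺; max≤v⁺)
open import Data.List.Membership.Propositional using (_∈_; _∉_; find)
open import Data.List.Membership.Propositional.Properties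
  using (∈-map⁺; ∈-map⁻; ∈-++⁺ˡ; ∈-++⁺ʳ; ∈-++⁻; ∈-concatMap⁺; ∈-concatMap⁻; ∈-filter⁺; ∈-filter⁻;
         ∈-∃++; ∈-upTo⁺; ∈-upTo⁻)
open import Data.List.Membership.Propositional.Properties.WithK using (unique∧set⇒bag)
open import Data.List.Properties
  using (++-assoc; ++-identityʳ; ++-cancelˡ; ++-cancelʳ; ∷-injectiveˡ; ∷-injectiveʳ; map-++; map-∘;
         length-map; map-injective; filter-++; filter-all; filter-none; filter-reject)
open import Data.List.Relation.Binary.BagAndSetEquality using (∼bag⇒↭)
open import Data.List.Relation.Binary.Permutation.Propositional
  using (_↭_; ↭-refl; ↭-sym; ↭-trans; ↭-reflexive; prep; swap; ↭⇒↭ₛ)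
import Data.List.Relation.Binary.Permutation.Propositional.Properties as Perm
import Data.List.Relation.Binary.Permutation.Setoid.Properties as PermSetoid
open import Data.List.Relation.Binary.Pointwise using (Pointwise; []; _∷_)
import Data.List.Relation.Binary.Pointwise as Pointwise
open import Data.List.Relation.Unary.All using ([]; _∷_)
import Data.List.Relation.Unary.All as All
import Data.List.Relation.Unary.Any as Any
open import Data.List.Relation.Unary.Any using (here; there)
open import Data.List.Relation.Unary.Unique.Propositional using (Unique; []; _∷_)
import Data.List.Relation.Unary.Unique.Propositional.Properties as Unique
open import Data.Maybe using (just; maybe′)
open import Data.Nat
  using (ℕ; zero; suc; _+_; _*_; _∸_; _<ᵇ_; _≡ᵇ_; _%_; _≤_; _<_; z≤n; s≤s; _≤?_; _<?_)
open import Data.Nat.DivMod using ([m+n]%n≡m%n)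
open import Data.Nat.Induction using (<-rec)
open import Data.Nat.Properties
open import Data.Nat.Solver using (module +-*-Solver)
open import Data.Product using (_×_; _,_; ∃; proj₁; proj₂)
open import Data.Sum using (inj₁; inj₂)
open import Function using (_∘_; id)
open import Function.Bundles using (mk⇔)
open import Relation.Binary.PropositionalEquality
  using (_≡_; _≢_; refl; sym; trans; cong; cong₂; subst; subst₂; setoid; module ≡-Reasoning)
open import Relation.Nullary using (¬_; yes; no)
open import Algebra.Properties.CommutativeSemigroup +-commutativeSemigroup
  using () renaming (interchange to +-interchange)

open import Defs

<ᵇ-true : ∀ {m n} → m < n → (m <ᵇ n) ≡ true
<ᵇ-true {zero} {suc n} _ = refl
<ᵇ-true {suc m} {suc n} (s≤s m<n) = <ᵇ-true m<n

<ᵇ-false : ∀ {m n} → n ≤ m → (m <ᵇ n) ≡ false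
<ᵇ-false {m} {zero} _ = refl
<ᵇ-false {suc m} {suc n} (s≤s n≤m) = <ᵇ-false n≤m

<ᵇ-true⁻ : ∀ {m n} → (m <ᵇ n) ≡ true → m < n
<ᵇ-true⁻ {zero} {suc n} _ = s≤s z≤n
<ᵇ-true⁻ {suc m} {suc n} eq = s≤s (<ᵇ-true⁻ eq)

+-cancelˡ-<ᵇ : ∀ c a b → (c + a <ᵇ c + b) ≡ (a <ᵇ b)
+-cancelˡ-<ᵇ zero a b = refl
+-cancelˡ-<ᵇ (suc c) a b = +-cancelˡ-<ᵇ c a b

true≢false : true ≢ false
true≢false ()

isEven-2+ : ∀ n → isEven (2 + n) ≡ isEven n
isEven-2+ n = cong (_≡ᵇ 0) (trans (cong (_% 2) (+-comm 2 n)) ([m+n]%n≡m%n n 2))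

isEven-suc : ∀ n → isEven (suc n) ≡ not (isEven n)
isEven-suc zero = refl
isEven-suc (suc zero) = refl
isEven-suc (suc (suc n)) = begin
  isEven (3 + n)       ≡⟨ isEven-2+ (suc n) ⟩
  isEven (suc n)       ≡⟨ isEven-suc n ⟩
  not (isEven n)       ≡⟨ cong not (sym (isEven-2+ n)) ⟩
  not (isEven (2 + n)) ∎
  where open ≡-Reasoning

isEven-+ : ∀ c a → isEven c ≡ true → isEven (c + a) ≡ isEven a
isEven-+ zero a _ = refl
isEven-+ (suc zero) a ()
isEven-+ (suc (suc c)) a ev = trans (isEven-2+ (c + a)) (isEven-+ c a (trans (sym (isEven-2+ c)) ev))

even⇒odd-suc : ∀ {n} → isEven n ≡ true → isEven (suc n) ≡ false
even⇒odd-suc {n} ev = trans (isEven-suc n) (cong not ev)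

odd⇒even-suc : ∀ {n} → isEven n ≡ false → isEven (suc n) ≡ true
odd⇒even-suc {n} od = trans (isEven-suc n) (cong not od)

∧-true⁻ : ∀ {a b} → a ∧ b ≡ true → a ≡ true × b ≡ true
∧-true⁻ {true} {true} _ = refl , refl

any-++ : ∀ {A : Set} (p : A → Bool) l m → any p (l ++ m) ≡ any p l ∨ any p m
any-++ p [] m = refl
any-++ p (x ∷ l) m = trans (cong (p x ∨_) (any-++ p l m)) (sym (∨-assoc (p x) _ _))

any-false : ∀ {A : Set} (p : A → Bool) l → (∀ {c} → c ∈ l → p c ≡ false) → any p l ≡ false
any-false p [] _ = refl
any-false p (x ∷ l) px rewrite px (here refl) = any-false p l (px ∘ there)

any-true : ∀ {A : Set} (p : A → Bool) l {c} → c ∈ l → p c ≡ true → any p l ≡ true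
any-true p (x ∷ l) (here refl) pc rewrite pc = refl
any-true p (x ∷ l) (there c∈) pc rewrite any-true p l c∈ pc = ∨-zeroʳ (p x)

all-++ : ∀ {A : Set} (p : A → Bool) l m → all p (l ++ m) ≡ all p l ∧ all p m
all-++ p [] m = refl
all-++ p (x ∷ l) m = trans (cong (p x ∧_) (all-++ p l m)) (sym (∧-assoc (p x) _ _))

Above : ℕ → List ℕ → Set
Above s l = ∀ {y} → y ∈ l → s < y

Below : ℕ → List ℕ → Set
Below s l = ∀ {y} → y ∈ l → y < s

AtMost : ℕ → List ℕ → Set
AtMost s l = ∀ {y} → y ∈ l → y ≤ s

raise : ℕ → List ℕ → List ℕ
raise c = map (c +_)

Above-+0 : ∀ {s l} → Above s l → Above (s + 0) l
Above-+0 {s} s<l {y} y∈ = subst (_< y) (sym (+-identityʳ s)) (s<l y∈)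

if-+ : ∀ (b : Bool) x y → (if b then x + y else 0) ≡ (if b then x else 0) + (if b then y else 0)
if-+ true x y = refl
if-+ false x y = refl

chains-atMost : ∀ k v m → AtMost v m → chains (suc k) v m ≡ 0
chains-atMost k v [] _ = refl
chains-atMost k v (a ∷ m) m≤v rewrite <ᵇ-false {v} {a} (m≤v (here refl)) =
  chains-atMost k v m (m≤v ∘ there)

chains-++-atMost : ∀ k v l m → AtMost v m → chains k v (l ++ m) ≡ chains k v l
chains-++-atMost zero v l m _ = refl
chains-++-atMost (suc k) v [] m m≤v = chains-atMost k v m m≤v
chains-++-atMost (suc k) v (a ∷ l) m m≤v with v <ᵇ a in v<a
... | true = cong₂ _+_ (chains-++-atMost k a l m (λ y∈ → ≤-trans (m≤v y∈) (<⇒≤ (<ᵇ-true⁻ v<a))))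
                       (chains-++-atMost (suc k) v l m m≤v)
... | false = chains-++-atMost (suc k) v l m m≤v

chains-[] : ∀ k t v → chains k t [] ≡ chains k v []
chains-[] zero t v = refl
chains-[] (suc k) t v = refl

-- A chain above a descent inside l never reaches the smaller entries of x ∷ m.
occ-++-descent : ∀ k s l x m → Above s l → AtMost s (x ∷ m) →
  occ k (l ++ x ∷ m) ≡ occ k (l ++ [ x ]) + occ k (x ∷ m)
occ-++-descent k s [] x m _ _ = refl
occ-++-descent k s (a ∷ []) x m s<l m≤s with x <ᵇ a
... | true = cong (_+ occ k (x ∷ m)) (trans (chains-++-atMost k a [] m m≤a) (sym (+-identityʳ _)))
  where
  m≤a : AtMost a m
  m≤a y∈ = ≤-trans (m≤s (there y∈)) (<⇒≤ (s<l (here refl)))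
... | false = refl
occ-++-descent k s (a ∷ b ∷ l) x m s<l m≤s =
  trans (cong₂ _+_ first (occ-++-descent k s (b ∷ l) x m (s<l ∘ there) m≤s))
        (sym (+-assoc (if b <ᵇ a then chains k a (l ++ [ x ]) else 0) _ _))
  where
  m≤a : AtMost a (x ∷ m)
  m≤a y∈ = ≤-trans (m≤s y∈) (<⇒≤ (s<l (here refl)))
  x≤a : AtMost a [ x ]
  x≤a (here refl) = m≤a (here refl)
  first : (if b <ᵇ a then chains k a (l ++ x ∷ m) else 0) ≡
          (if b <ᵇ a then chains k a (l ++ [ x ]) else 0)
  first = cong (λ z → if b <ᵇ a then z else 0)
    (trans (chains-++-atMost k a l (x ∷ m) m≤a) (sym (chains-++-atMost k a l [ x ] x≤a)))

occ-∷ʳ-low : ∀ k l x y → Above x l → Above y l → occ k (l ++ [ x ]) ≡ occ k (l ++ [ y ])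
occ-∷ʳ-low k [] x y _ _ = refl
occ-∷ʳ-low k (a ∷ []) x y x<l y<l
  rewrite <ᵇ-true (x<l (here refl)) | <ᵇ-true (y<l (here refl)) = refl
occ-∷ʳ-low k (a ∷ b ∷ l) x y x<l y<l =
  cong₂ _+_ (cong (λ z → if b <ᵇ a then z else 0)
                  (trans (chains-++-atMost k a l [ x ] x≤a) (sym (chains-++-atMost k a l [ y ] y≤a))))
            (occ-∷ʳ-low k (b ∷ l) x y (x<l ∘ there) (y<l ∘ there))
  where
  x≤a : AtMost a [ x ]
  x≤a (here refl) = <⇒≤ (x<l (here refl))
  y≤a : AtMost a [ y ]
  y≤a (here refl) = <⇒≤ (y<l (here refl))

chains-raise : ∀ k c v l → chains k (c + v) (raise c l) ≡ chains k v l
chains-raise zero c v l = refl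
chains-raise (suc k) c v [] = refl
chains-raise (suc k) c v (a ∷ l) rewrite +-cancelˡ-<ᵇ c v a with v <ᵇ a
... | true = cong₂ _+_ (chains-raise k c a l) (chains-raise (suc k) c v l)
... | false = chains-raise (suc k) c v l

occ-raise : ∀ k c l → occ k (raise c l) ≡ occ k l
occ-raise k c [] = refl
occ-raise k c (a ∷ []) = refl
occ-raise k c (a ∷ b ∷ l) =
  cong₂ _+_ (trans (cong (λ z → if z then chains k (c + a) (raise c l) else 0) (+-cancelˡ-<ᵇ c b a))
                   (cong (λ z → if b <ᵇ a then z else 0) (chains-raise k c a l)))
            (occ-raise k c (b ∷ l))

chains-∷ʳ-max : ∀ k v t l → v < t → Below t l →
  chains (suc k) v (l ++ [ t ]) ≡ chains (suc k) v l + chains k v l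
chains-∷ʳ-max k v t [] v<t _ rewrite <ᵇ-true v<t = trans (+-identityʳ _) (chains-[] k t v)
chains-∷ʳ-max zero v t (a ∷ l) v<t l<t with v <ᵇ a
... | true = trans (cong (1 +_) (chains-∷ʳ-max zero v t l v<t (l<t ∘ there))) (sym (+-assoc 1 _ 1))
... | false = chains-∷ʳ-max zero v t l v<t (l<t ∘ there)
chains-∷ʳ-max (suc k) v t (a ∷ l) v<t l<t with v <ᵇ a
... | true = trans (cong₂ _+_ (chains-∷ʳ-max k a t l (l<t (here refl)) (l<t ∘ there))
                              (chains-∷ʳ-max (suc k) v t l v<t (l<t ∘ there)))
                   (+-interchange (chains (suc k) a l) (chains k a l) _ _)
... | false = chains-∷ʳ-max (suc k) v t l v<t (l<t ∘ there)

occ₀-∷ʳ-max : ∀ t l → Below t l → occ 0 (l ++ [ t ]) ≡ occ 0 l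
occ₀-∷ʳ-max t [] _ = refl
occ₀-∷ʳ-max t (a ∷ []) l<t rewrite <ᵇ-false {t} {a} (<⇒≤ (l<t (here refl))) = refl
occ₀-∷ʳ-max t (a ∷ b ∷ l) l<t =
  cong ((if b <ᵇ a then 1 else 0) +_) (occ₀-∷ʳ-max t (b ∷ l) (l<t ∘ there))

occ-suc-∷ʳ-max : ∀ k t l → Below t l → occ (suc k) (l ++ [ t ]) ≡ occ (suc k) l + occ k l
occ-suc-∷ʳ-max k t [] _ = refl
occ-suc-∷ʳ-max k t (a ∷ []) l<t rewrite <ᵇ-false {t} {a} (<⇒≤ (l<t (here refl))) = refl
occ-suc-∷ʳ-max k t (a ∷ b ∷ l) l<t =
  trans (cong₂ _+_ (trans (cong (λ z → if b <ᵇ a then z else 0)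
                                (chains-∷ʳ-max k a t l (l<t (here refl)) (l<t ∘ there ∘ there)))
                          (if-+ (b <ᵇ a) _ _))
                   (occ-suc-∷ʳ-max k t (b ∷ l) (l<t ∘ there)))
        (+-interchange (if b <ᵇ a then chains (suc k) a l else 0) (if b <ᵇ a then chains k a l else 0)
                       _ _)

occ-∷-max : ∀ k t l y → Below t (l ++ [ y ]) →
  occ k (t ∷ l ++ [ y ]) ≡ chains k t [] + occ k (l ++ [ y ])
occ-∷-max k t [] y l<t rewrite <ᵇ-true (l<t (here refl)) = refl
occ-∷-max k t (x ∷ l) y l<t rewrite <ᵇ-true (l<t (here refl)) =
  cong (_+ _) (chains-++-atMost k t [] (l ++ [ y ]) (λ y∈ → <⇒≤ (l<t (there y∈))))

occ-∷ʳ-min : ∀ k l a z → (∀ {v} → v ∈ l → z ≤ v) → z < a →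
  occ k (l ++ a ∷ z ∷ []) ≡ occ k (l ++ [ a ]) + chains k a []
occ-∷ʳ-min k [] a z _ z<a rewrite <ᵇ-true z<a = +-identityʳ _
occ-∷ʳ-min k (b ∷ []) a z z≤l z<a rewrite <ᵇ-true z<a =
  trans (cong₂ _+_ (cong (λ w → if a <ᵇ b then w else 0) (chains-++-atMost k b [] [ z ] z≤b))
                   (+-identityʳ _))
        (cong (_+ chains k a []) (sym (+-identityʳ _)))
  where
  z≤b : AtMost b [ z ]
  z≤b (here refl) = z≤l (here refl)
occ-∷ʳ-min k (b ∷ c ∷ l) a z z≤l z<a =
  trans (cong₂ _+_ first (occ-∷ʳ-min k (c ∷ l) a z (z≤l ∘ there) z<a))
        (sym (+-assoc (if c <ᵇ b then chains k b (l ++ [ a ]) else 0) _ _))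
  where
  z≤b : AtMost b [ z ]
  z≤b (here refl) = z≤l (here refl)
  first : (if c <ᵇ b then chains k b (l ++ a ∷ z ∷ []) else 0) ≡
          (if c <ᵇ b then chains k b (l ++ [ a ]) else 0)
  first = cong (λ w → if c <ᵇ b then w else 0)
    (trans (cong (chains k b) (sym (++-assoc l [ a ] [ z ]))) (chains-++-atMost k b (l ++ [ a ]) [ z ] z≤b))

chains-long : ∀ k v l → length l < k → chains k v l ≡ 0
chains-long (suc k) v [] _ = refl
chains-long (suc k) v (a ∷ l) (s≤s l<k) with v <ᵇ a
... | true = cong₂ _+_ (chains-long k a l l<k) (chains-long (suc k) v l (≤-trans l<k (n≤1+n k)))
... | false = chains-long (suc k) v l (≤-trans l<k (n≤1+n k))

occ-long : ∀ k π → length π ≤ suc k → occ k π ≡ 0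
occ-long k [] _ = refl
occ-long k (a ∷ []) _ = refl
occ-long zero (a ∷ b ∷ l) (s≤s ())
occ-long (suc k) (a ∷ b ∷ l) (s≤s π≤k) =
  cong₂ _+_ (trans (cong (λ z → if b <ᵇ a then z else 0) (chains-long (suc k) a l π≤k)) (if-0 (b <ᵇ a)))
            (occ-long (suc k) (b ∷ l) (≤-trans π≤k (n≤1+n _)))
  where
  if-0 : ∀ b → (if b then 0 else 0) ≡ 0
  if-0 true = refl
  if-0 false = refl

occ-raise-++ : ∀ k s c x r → Above s (raise s c) → AtMost s (x ∷ r) →
  occ k (raise s c ++ x ∷ r) ≡ occ k (c ++ [ 0 ]) + occ k (x ∷ r)
occ-raise-++ k s c x r s<c r≤s = trans (occ-++-descent k s (raise s c) x r s<c r≤s)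
  (cong (_+ occ k (x ∷ r)) (trans (occ-∷ʳ-low k (raise s c) x (s + 0) x<c (Above-+0 s<c))
    (trans (cong (occ k) (sym (map-++ (s +_) c [ 0 ]))) (occ-raise k s (c ++ [ 0 ])))))
  where
  x<c : Above x (raise s c)
  x<c y∈ = ≤-<-trans (r≤s (here refl)) (s<c y∈)

-- exponent m k is the exponent of x_(k+2) in m.
exponent : Mono → ℕ → ℕ
exponent [] _ = 0
exponent (a ∷ m) zero = a
exponent (a ∷ m) (suc k) = exponent m k

exponent-addM : ∀ a b k → exponent (addM a b) k ≡ exponent a k + exponent b k
exponent-addM [] b k = refl
exponent-addM (x ∷ a) [] k = sym (+-identityʳ _)
exponent-addM (x ∷ a) (y ∷ b) zero = refl
exponent-addM (x ∷ a) (y ∷ b) (suc k) = exponent-addM a b k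

exponent-applyUpTo : ∀ f n k → exponent (applyUpTo f n) k ≡ (if k <ᵇ n then f k else 0)
exponent-applyUpTo f zero k = refl
exponent-applyUpTo f (suc n) zero = refl
exponent-applyUpTo f (suc n) (suc k) = exponent-applyUpTo (f ∘ suc) n k

norm-cong : ∀ m m′ → (∀ k → exponent m k ≡ exponent m′ k) → norm m ≡ norm m′
norm-cong [] [] _ = refl
norm-cong [] (b ∷ m′) eq with eq zero | norm-cong [] m′ (eq ∘ suc)
... | refl | m′≡[] rewrite sym m′≡[] = refl
norm-cong (a ∷ m) [] eq with eq zero | norm-cong m [] (eq ∘ suc)
... | refl | m≡[] rewrite m≡[] = refl
norm-cong (a ∷ m) (b ∷ m′) eq with eq zero
... | refl = cong (consN a) (norm-cong m m′ (eq ∘ suc))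

-- σ₂ is σ₁ applied twice, as an inner block appends two new maxima.
exponent-σ₂ : ∀ e k → exponent (σ₂ e) k ≡ exponent (σ₁ (σ₁ e)) k
exponent-σ₂ e k = begin
  exponent (σ₂ e) k                           ≡⟨ exponent-addM e _ k ⟩
  e₀ + exponent (addM (0 ∷ map (2 *_) e) (0 ∷ 0 ∷ e)) k
    ≡⟨ cong (e₀ +_) (trans (exponent-addM (0 ∷ map (2 *_) e) (0 ∷ 0 ∷ e) k) (cong (_+ e₂) (doubled k))) ⟩
  e₀ + (2 * e₁ + e₂)                          ≡⟨ regroup e₀ e₁ e₂ ⟩
  (e₀ + e₁) + (e₁ + e₂)                       ≡⟨ cong₂ _+_ (sym (exponent-addM e (0 ∷ e) k)) (sym (shifted k)) ⟩
  exponent (σ₁ e) k + exponent (0 ∷ σ₁ e) k   ≡⟨ sym (exponent-addM (σ₁ e) (0 ∷ σ₁ e) k) ⟩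
  exponent (σ₁ (σ₁ e)) k                      ∎
  where
  open ≡-Reasoning
  e₀ = exponent e k
  e₁ = exponent (0 ∷ e) k
  e₂ = exponent (0 ∷ 0 ∷ e) k
  regroup : ∀ a b c → a + (2 * b + c) ≡ (a + b) + (b + c)
  regroup = solve 3 (λ a b c → a :+ (con 2 :* b :+ c) := (a :+ b) :+ (b :+ c)) refl
    where open +-*-Solver
  doubled : ∀ k → exponent (0 ∷ map (2 *_) e) k ≡ 2 * exponent (0 ∷ e) k
  doubled zero = refl
  doubled (suc k) = go e k
    where
    go : ∀ e k → exponent (map (2 *_) e) k ≡ 2 * exponent e k
    go [] k = refl
    go (x ∷ e) zero = refl
    go (x ∷ e) (suc k) = go e k
  shifted : ∀ k → exponent (0 ∷ σ₁ e) k ≡ exponent (0 ∷ e) k + exponent (0 ∷ 0 ∷ e) k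
  shifted zero = refl
  shifted (suc k) = exponent-addM e (0 ∷ e) k

infix 4 _HasWeight_

record _HasWeight_ (π : List ℕ) (w : Mono) : Set where
  constructor weighs
  field occ≡exponent : ∀ k → occ k π ≡ exponent w k
open _HasWeight_

weight-hasWeight : ∀ π → π HasWeight weight π
weight-hasWeight π = weighs occ≡
  where
  exponent-weight : ∀ k → exponent (weight π) k ≡ (if k <ᵇ length π then occ k π else 0)
  exponent-weight = exponent-applyUpTo (λ j → occ j π) (length π)
  occ≡ : ∀ k → occ k π ≡ exponent (weight π) k
  occ≡ k with k <? length π
  ... | yes k<π = sym (trans (exponent-weight k) (cong (λ b → if b then occ k π else 0) (<ᵇ-true k<π)))
  ... | no k≮π = trans (occ-long k π (≤-trans (≮⇒≥ k≮π) (n≤1+n k)))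
    (sym (trans (exponent-weight k) (cong (λ b → if b then occ k π else 0) (<ᵇ-false (≮⇒≥ k≮π)))))

norm-weight : ∀ {π w} → π HasWeight w → norm (weight π) ≡ norm w
norm-weight {π} {w} (weighs π∶w) =
  norm-cong (weight π) w (λ k → trans (sym (occ≡exponent (weight-hasWeight π) k)) (π∶w k))

hasWeight-cong : ∀ {π w w′} → (∀ k → exponent w k ≡ exponent w′ k) →
  π HasWeight w → π HasWeight w′
hasWeight-cong w≈w′ (weighs π∶w) = weighs (λ k → trans (π∶w k) (w≈w′ k))

-- A new maximum at the end extends every increasing chain by one entry: this is σ₁.
hasWeight-∷ʳ-max : ∀ {l w t} → Below t l → l HasWeight w → (l ++ [ t ]) HasWeight σ₁ w
hasWeight-∷ʳ-max {l} {w} {t} l<t (weighs l∶w) = weighs occ≡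
  where
  occ≡ : ∀ k → occ k (l ++ [ t ]) ≡ exponent (σ₁ w) k
  occ≡ zero = trans (occ₀-∷ʳ-max t l l<t)
    (trans (l∶w 0) (trans (sym (+-identityʳ _)) (sym (exponent-addM w (0 ∷ w) 0))))
  occ≡ (suc k) = trans (occ-suc-∷ʳ-max k t l l<t)
    (trans (cong₂ _+_ (l∶w (suc k)) (l∶w k)) (sym (exponent-addM w (0 ∷ w) (suc k))))

chains-[]≡exponent-1 : ∀ k t → chains k t [] ≡ exponent [ 1 ] k
chains-[]≡exponent-1 zero t = refl
chains-[]≡exponent-1 (suc k) t = refl

hasWeight-∷-max : ∀ {l y w t} → Below t (l ++ [ y ]) → (l ++ [ y ]) HasWeight w →
  (t ∷ l ++ [ y ]) HasWeight addM [ 1 ] w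
hasWeight-∷-max {l} {y} {w} {t} l<t (weighs l∶w) = weighs λ k →
  trans (occ-∷-max k t l y l<t)
    (trans (cong₂ _+_ (chains-[]≡exponent-1 k t) (l∶w k)) (sym (exponent-addM [ 1 ] w k)))

hasWeight-∷ʳ-0 : ∀ {l a w} → 0 < a → (l ++ [ a ]) HasWeight w →
  (l ++ a ∷ 0 ∷ []) HasWeight addM [ 1 ] w
hasWeight-∷ʳ-0 {l} {a} {w} 0<a (weighs l∶w) = weighs λ k → begin
  occ k (l ++ a ∷ 0 ∷ [])              ≡⟨ occ-∷ʳ-min k l a 0 (λ _ → z≤n) 0<a ⟩
  occ k (l ++ [ a ]) + chains k a []   ≡⟨ cong₂ _+_ (l∶w k) (chains-[]≡exponent-1 k a) ⟩
  exponent w k + exponent [ 1 ] k      ≡⟨ +-comm (exponent w k) _ ⟩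
  exponent [ 1 ] k + exponent w k      ≡⟨ sym (exponent-addM [ 1 ] w k) ⟩
  exponent (addM [ 1 ] w) k            ∎
  where open ≡-Reasoning

hasWeight-raise-++ : ∀ {s c x r u v} → Above s (raise s c) → AtMost s (x ∷ r) →
  (c ++ [ 0 ]) HasWeight u → (x ∷ r) HasWeight v → (raise s c ++ x ∷ r) HasWeight addM u v
hasWeight-raise-++ {s} {c} {x} {r} {u} {v} s<c r≤s (weighs c∶u) (weighs r∶v) = weighs λ k →
  trans (occ-raise-++ k s c x r s<c r≤s) (trans (cong₂ _+_ (c∶u k) (r∶v k)) (sym (exponent-addM u v k)))

Unique-concatMap : ∀ {A B : Set} (f : A → List B) (key : B → A) {xs} → Unique xs →
  (∀ {a} → a ∈ xs → Unique (f a)) → (∀ {a y} → a ∈ xs → y ∈ f a → key y ≡ a) →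
  Unique (concatMap f xs)
Unique-concatMap f key [] _ _ = []
Unique-concatMap f key {a ∷ xs} (a∉xs ∷ xs!) f! key-f =
  Unique.++⁺ (f! (here refl)) (Unique-concatMap f key xs! (f! ∘ there) (key-f ∘ there)) disjoint
  where
  disjoint : ∀ {v} → ¬ (v ∈ f a × v ∈ concatMap f xs)
  disjoint (v∈fa , v∈rest) with find (∈-concatMap⁻ f {xs = xs} v∈rest)
  ... | b , b∈xs , v∈fb =
    All.lookup a∉xs b∈xs (trans (sym (key-f (here refl) v∈fa)) (key-f (there b∈xs) v∈fb))

↭-fromMembership : ∀ {A : Set} {xs ys : List A} → Unique xs → Unique ys →
  (∀ {x} → x ∈ xs → x ∈ ys) → (∀ {x} → x ∈ ys → x ∈ xs) → xs ↭ ys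
↭-fromMembership xs! ys! to from = ∼bag⇒↭ (unique∧set⇒bag xs! ys! (mk⇔ to from))

Unique-resp-↭ : ∀ {A : Set} {xs ys : List A} → xs ↭ ys → Unique xs → Unique ys
Unique-resp-↭ {A} p = PermSetoid.Unique-resp-↭ (setoid A) (↭⇒↭ₛ p)

Unique-++-disjoint : ∀ {A : Set} {l m : List A} {x y} → Unique (l ++ m) → x ∈ l → y ∈ m → x ≢ y
Unique-++-disjoint {l = a ∷ l} (a∉ ∷ _) (here refl) y∈ = All.lookup a∉ (∈-++⁺ʳ l y∈)
Unique-++-disjoint {l = a ∷ l} (_ ∷ l!) (there x∈) y∈ = Unique-++-disjoint l! x∈ y∈

take-length-++ : ∀ {A : Set} (l m : List A) → take (length l) (l ++ m) ≡ l
take-length-++ [] m = refl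
take-length-++ (x ∷ l) m = cong (x ∷_) (take-length-++ l m)

drop-length-++ : ∀ {A : Set} (l m : List A) → drop (length l) (l ++ m) ≡ m
drop-length-++ [] m = refl
drop-length-++ (x ∷ l) m = drop-length-++ l m

last-∷ʳ : ∀ {A : Set} (l : List A) x → last (l ++ [ x ]) ≡ just x
last-∷ʳ [] x = refl
last-∷ʳ (a ∷ []) x = refl
last-∷ʳ (a ∷ b ∷ l) x = last-∷ʳ (b ∷ l) x

range : ℕ → List ℕ
range zero = []
range (suc n) = suc n ∷ range n

∈-range⁻ : ∀ {x n} → x ∈ range n → 1 ≤ x × x ≤ n
∈-range⁻ {n = suc n} (here refl) = s≤s z≤n , ≤-refl
∈-range⁻ {n = suc n} (there x∈) = proj₁ (∈-range⁻ x∈) , m≤n⇒m≤1+n (proj₂ (∈-range⁻ x∈))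

∈-range⁺ : ∀ {x n} → 1 ≤ x → x ≤ n → x ∈ range n
∈-range⁺ {suc x} {zero} _ ()
∈-range⁺ {x} {suc n} 1≤x x≤n with x ≟ suc n
... | yes refl = here refl
... | no x≢n = there (∈-range⁺ 1≤x (≤-pred (≤∧≢⇒< x≤n x≢n)))

length-range : ∀ n → length (range n) ≡ n
length-range zero = refl
length-range (suc n) = cong suc (length-range n)

Unique-range : ∀ n → Unique (range n)
Unique-range zero = []
Unique-range (suc n) =
  All.tabulate (λ x∈ n≡x → 1+n≰n (subst (_≤ n) (sym n≡x) (proj₂ (∈-range⁻ x∈)))) ∷ Unique-range n

range-+ : ∀ m i → range (m + i) ≡ raise i (range m) ++ range i
range-+ zero i = refl
range-+ (suc m) i = cong₂ _∷_ (trans (cong suc (+-comm m i)) (sym (+-suc i m))) (range-+ m i)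

Above-raise : ∀ s {c i} → c ↭ range i → Above s (raise s c)
Above-raise s c↭ y∈ with ∈-map⁻ (s +_) y∈
... | z , z∈ , refl =
  subst (_< s + z) (+-identityʳ s) (+-monoʳ-< s (proj₁ (∈-range⁻ (Perm.∈-resp-↭ c↭ z∈))))

AtMost-range : ∀ {s g} → g ↭ range s → AtMost s g
AtMost-range g↭ y∈ = proj₂ (∈-range⁻ (Perm.∈-resp-↭ g↭ y∈))

Below-range : ∀ {s g} → g ↭ range s → Below (suc s) g
Below-range g↭ y∈ = s≤s (AtMost-range g↭ y∈)

AtMost-∷ʳ-0 : ∀ {s l} → AtMost s l → AtMost s (l ++ [ 0 ])
AtMost-∷ʳ-0 {l = l} l≤s y∈ with ∈-++⁻ l y∈
... | inj₁ y∈l = l≤s y∈l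
... | inj₂ (here refl) = z≤n

raise-++-↭ : ∀ {i j c g} → c ↭ range i → g ↭ range j → raise j c ++ g ↭ range (i + j)
raise-++-↭ {i} {j} c↭ g↭ = subst (_ ↭_) (sym (range-+ i j)) (Perm.++⁺ (Perm.map⁺ (j +_) c↭) g↭)

∷ʳ-↭-range : ∀ {γ j} → γ ↭ range j → γ ++ [ suc j ] ↭ range (suc j)
∷ʳ-↭-range {γ} {j} γ↭ = ↭-trans (Perm.++-comm γ [ suc j ]) (prep (suc j) γ↭)

map-∸-raise : ∀ K l → map (_∸ K) (raise K l) ≡ l
map-∸-raise K [] = refl
map-∸-raise K (x ∷ l) = cong₂ _∷_ (m+n∸m≡n K x) (map-∸-raise K l)

length-↭-range : ∀ {l n} → l ↭ range n → length l ≡ n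
length-↭-range l↭ = trans (Perm.↭-length l↭) (length-range _)

length-raise : ∀ c {l n} → l ↭ range n → length (raise c l) ≡ n
length-raise c {l} l↭ = trans (length-map (c +_) l) (length-↭-range l↭)

raise-injective : ∀ c {x y} → raise c x ≡ raise c y → x ≡ y
raise-injective c = map-injective (+-cancelˡ-≡ c _ _)

raise-raise : ∀ i d l → raise i (raise d l) ≡ raise (i + d) l
raise-raise i d [] = refl
raise-raise i d (x ∷ l) = cong₂ _∷_ (sym (+-assoc i d x)) (raise-raise i d l)

drop-max-↭ : ∀ {j} α β → α ++ suc j ∷ β ↭ range (suc j) → α ++ β ↭ range j
drop-max-↭ {j} α β π↭ = Perm.drop-∷ (↭-trans (↭-sym (Perm.shift (suc j) α β)) π↭)

∈-ins⇒↭ : ∀ a τ {σ} → σ ∈ ins a τ → σ ↭ a ∷ τ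
∈-ins⇒↭ a [] (here refl) = ↭-refl
∈-ins⇒↭ a (b ∷ l) (here refl) = ↭-refl
∈-ins⇒↭ a (b ∷ l) (there σ∈) with ∈-map⁻ (b ∷_) σ∈
... | σ′ , σ′∈ , refl = ↭-trans (prep b (∈-ins⇒↭ a l σ′∈)) (swap b a ↭-refl)

∈-ins : ∀ a α β → α ++ a ∷ β ∈ ins a (α ++ β)
∈-ins a [] [] = here refl
∈-ins a [] (b ∷ β) = here refl
∈-ins a (c ∷ α) β = there (∈-map⁺ (c ∷_) (∈-ins a α β))

∈-perms⁻ : ∀ n {π} → π ∈ perms n → π ↭ range n
∈-perms⁻ zero (here refl) = ↭-refl
∈-perms⁻ (suc n) π∈ with find (∈-concatMap⁻ (ins (suc n)) {xs = perms n} π∈)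
... | τ , τ∈ , π∈ins = ↭-trans (∈-ins⇒↭ (suc n) τ π∈ins) (prep (suc n) (∈-perms⁻ n τ∈))

∈-perms⁺ : ∀ n {π} → π ↭ range n → π ∈ perms n
∈-perms⁺ zero π↭ rewrite Perm.↭-empty-inv π↭ = here refl
∈-perms⁺ (suc n) π↭ with ∈-∃++ (Perm.∈-resp-↭ (↭-sym π↭) (here refl))
... | α , β , refl =
  ∈-concatMap⁺ (ins (suc n))
    (Any.map (λ { refl → ∈-ins (suc n) α β }) (∈-perms⁺ n (drop-max-↭ α β π↭)))

remove : ℕ → List ℕ → List ℕ
remove a [] = []
remove a (b ∷ l) with a ≟ b
... | yes _ = l
... | no _ = b ∷ remove a l

remove-self : ∀ a l → remove a (a ∷ l) ≡ l
remove-self a l with a ≟ a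
... | yes _ = refl
... | no a≢a = ⊥-elim (a≢a refl)

remove-ins : ∀ a τ {σ} → a ∉ τ → σ ∈ ins a τ → remove a σ ≡ τ
remove-ins a [] _ (here refl) = remove-self a []
remove-ins a (b ∷ l) _ (here refl) = remove-self a (b ∷ l)
remove-ins a (b ∷ l) a∉τ (there σ∈) with ∈-map⁻ (b ∷_) σ∈
... | σ′ , σ′∈ , refl with a ≟ b
...   | yes a≡b = ⊥-elim (a∉τ (here a≡b))
...   | no _ = cong (b ∷_) (remove-ins a l (a∉τ ∘ there) σ′∈)

Unique-ins : ∀ a τ → a ∉ τ → Unique (ins a τ)
Unique-ins a [] _ = [] ∷ []
Unique-ins a (b ∷ l) a∉τ =
  All.tabulate head-fresh ∷ Unique.map⁺ ∷-injectiveʳ (Unique-ins a l (a∉τ ∘ there))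
  where
  head-fresh : ∀ {y} → y ∈ map (b ∷_) (ins a l) → a ∷ b ∷ l ≢ y
  head-fresh y∈ eq with ∈-map⁻ (b ∷_) y∈
  ... | _ , _ , refl = a∉τ (here (∷-injectiveˡ eq))

Unique-perms : ∀ n → Unique (perms n)
Unique-perms zero = [] ∷ []
Unique-perms (suc n) = Unique-concatMap (ins (suc n)) (remove (suc n)) (Unique-perms n)
  (λ τ∈ → Unique-ins (suc n) _ (fresh τ∈)) (λ τ∈ → remove-ins (suc n) _ (fresh τ∈))
  where
  fresh : ∀ {τ} → τ ∈ perms n → suc n ∉ τ
  fresh τ∈ n∈ = 1+n≰n (proj₂ (∈-range⁻ (Perm.∈-resp-↭ (∈-perms⁻ n τ∈) n∈)))

record IsD (n : ℕ) (π : List ℕ) : Set where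
  constructor isD
  field
    perm : π ↭ range n
    dumont : isDumont π ≡ true
    avoids : contains132 π ≡ false

dumontPerms : ℕ → List (List ℕ)
dumontPerms n = filter (λ π → inD π ≟B true) (perms n)

∈-dumontPerms⁻ : ∀ n {π} → π ∈ dumontPerms n → IsD n π
∈-dumontPerms⁻ n {π} π∈ with ∈-filter⁻ (λ π → inD π ≟B true) {xs = perms n} π∈
... | π∈perms , inDπ = isD (∈-perms⁻ n π∈perms) (proj₁ (split inDπ)) (proj₂ (split inDπ))
  where
  split : isDumont π ∧ not (contains132 π) ≡ true → isDumont π ≡ true × contains132 π ≡ false
  split eq with isDumont π | contains132 π | eq
  ... | true | false | _ = refl , refl
  ... | true | true | ()
  ... | false | _ | ()

∈-dumontPerms⁺ : ∀ n {π} → IsD n π → π ∈ dumontPerms n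
∈-dumontPerms⁺ n {π} (isD π↭ dum avoid) =
  ∈-filter⁺ (λ π → inD π ≟B true) (∈-perms⁺ n π↭) inDπ
  where
  inDπ : isDumont π ∧ not (contains132 π) ≡ true
  inDπ rewrite dum | avoid = refl

Unique-dumontPerms : ∀ n → Unique (dumontPerms n)
Unique-dumontPerms n = Unique.filter⁺ (λ π → inD π ≟B true) (Unique-perms n)

dumontStep : ℕ → ℕ → Bool
dumontStep a b = if isEven a then b <ᵇ a else a <ᵇ b

headOr : List ℕ → ℕ → ℕ
headOr [] x = x
headOr (b ∷ _) x = b

isDumontBefore : List ℕ → ℕ → Bool
isDumontBefore [] x = true
isDumontBefore (a ∷ l) x = dumontStep a (headOr l x) ∧ isDumontBefore l x

isDumont-++ : ∀ l x m → isDumont (l ++ x ∷ m) ≡ isDumontBefore l x ∧ isDumont (x ∷ m)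
isDumont-++ [] x m = refl
isDumont-++ (a ∷ []) x m = cong (_∧ isDumont (x ∷ m)) (sym (∧-identityʳ _))
isDumont-++ (a ∷ b ∷ l) x m =
  trans (cong (dumontStep a b ∧_) (isDumont-++ (b ∷ l) x m)) (sym (∧-assoc (dumontStep a b) _ _))

isDumont-++⁻ : ∀ l x m → isDumont (l ++ x ∷ m) ≡ true →
  isDumontBefore l x ≡ true × isDumont (x ∷ m) ≡ true
isDumont-++⁻ l x m dum = ∧-true⁻ (trans (sym (isDumont-++ l x m)) dum)

isDumontBefore-++ : ∀ l m x →
  isDumontBefore (l ++ m) x ≡ isDumontBefore l (headOr m x) ∧ isDumontBefore m x
isDumontBefore-++ [] m x = refl
isDumontBefore-++ (a ∷ []) [] x = sym (∧-identityʳ (dumontStep a x ∧ true))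
isDumontBefore-++ (a ∷ []) (b ∷ m) x =
  cong (_∧ isDumontBefore (b ∷ m) x) (sym (∧-identityʳ (dumontStep a b)))
isDumontBefore-++ (a ∷ b ∷ l) m x =
  trans (cong (dumontStep a b ∧_) (isDumontBefore-++ (b ∷ l) m x)) (sym (∧-assoc (dumontStep a b) _ _))

isDumont-tail : ∀ a b l → isDumont (a ∷ b ∷ l) ≡ true → isDumont (b ∷ l) ≡ true
isDumont-tail a b l dum with dumontStep a b | dum
... | true | d = d

dumontStep-even : ∀ {a y} → isEven a ≡ true → y < a → dumontStep a y ≡ true
dumontStep-even ev y<a rewrite ev = <ᵇ-true y<a

dumontStep-odd : ∀ {a y} → isEven a ≡ false → a < y → dumontStep a y ≡ true
dumontStep-odd od a<y rewrite od = <ᵇ-true a<y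

dumontStep-odd-≤ : ∀ {a y} → isEven a ≡ false → y ≤ a → dumontStep a y ≡ false
dumontStep-odd-≤ od y≤a rewrite od = <ᵇ-false y≤a

dumontStep-raise : ∀ c a b → isEven c ≡ true → dumontStep (c + a) (c + b) ≡ dumontStep a b
dumontStep-raise c a b ev rewrite isEven-+ c a ev | +-cancelˡ-<ᵇ c a b | +-cancelˡ-<ᵇ c b a = refl

headOr-raise : ∀ c l x → headOr (raise c l) (c + x) ≡ c + headOr l x
headOr-raise c [] x = refl
headOr-raise c (b ∷ l) x = refl

isDumontBefore-raise : ∀ c l x → isEven c ≡ true →
  isDumontBefore (raise c l) (c + x) ≡ isDumontBefore l x
isDumontBefore-raise c [] x ev = refl
isDumontBefore-raise c (a ∷ l) x ev
  rewrite headOr-raise c l x | dumontStep-raise c a (headOr l x) ev | isDumontBefore-raise c l x ev = refl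

headOr-below : ∀ {t} l x → Below t l → x < t → headOr l x < t
headOr-below [] x _ x<t = x<t
headOr-below (b ∷ l) x l<t _ = l<t (here refl)

Above-raise-headOr : ∀ {s c i} g → c ↭ range i → AtMost s g → Above (headOr g 0) (raise s c)
Above-raise-headOr [] c↭ _ y∈ = ≤-<-trans z≤n (Above-raise _ c↭ y∈)
Above-raise-headOr (y ∷ g) c↭ g≤s y∈ = ≤-<-trans (g≤s (here refl)) (Above-raise _ c↭ y∈)

isDumontBefore-low : ∀ l x y → Above x l → Above y l → isDumontBefore l x ≡ isDumontBefore l y
isDumontBefore-low [] x y _ _ = refl
isDumontBefore-low (a ∷ []) x y x<l y<l = cong (_∧ true) (step (isEven a))
  where
  step : ∀ b → (if b then x <ᵇ a else a <ᵇ x) ≡ (if b then y <ᵇ a else a <ᵇ y)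
  step true rewrite <ᵇ-true (x<l (here refl)) | <ᵇ-true (y<l (here refl)) = refl
  step false rewrite <ᵇ-false {a} {x} (<⇒≤ (x<l (here refl))) | <ᵇ-false {a} {y} (<⇒≤ (y<l (here refl))) =
    refl
isDumontBefore-low (a ∷ b ∷ l) x y x<l y<l =
  cong (dumontStep a b ∧_) (isDumontBefore-low (b ∷ l) x y (x<l ∘ there) (y<l ∘ there))

isDumontBefore-high : ∀ l x → Below x l → isDumontBefore l x ≡ isDumont l
isDumontBefore-high [] x _ = refl
isDumontBefore-high (a ∷ []) x l<x with isEven a
... | true rewrite <ᵇ-false {x} {a} (<⇒≤ (l<x (here refl))) = refl
... | false rewrite <ᵇ-true (l<x (here refl)) = refl
isDumontBefore-high (a ∷ b ∷ l) x l<x =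
  cong (dumontStep a b ∧_) (isDumontBefore-high (b ∷ l) x (l<x ∘ there))

even-followed-by-smaller : ∀ u e v x → isDumontBefore (u ++ e ∷ v) x ≡ true → isEven e ≡ true →
  headOr v x < e
even-followed-by-smaller [] e v x dum ev with ∧-true⁻ {dumontStep e (headOr v x)} dum
... | step , _ rewrite ev = <ᵇ-true⁻ step
even-followed-by-smaller (a ∷ u) e v x dum ev =
  even-followed-by-smaller u e v x (proj₂ (∧-true⁻ {dumontStep a (headOr (u ++ e ∷ v) x)} dum)) ev

between : ℕ → ℕ → ℕ → Bool
between a b c = (a <ᵇ c) ∧ (c <ᵇ b)

has32above-atMost : ∀ a m → AtMost a m → has32above a m ≡ false
has32above-atMost a [] _ = refl
has32above-atMost a (b ∷ m) m≤a
  rewrite any-false (between a b) m (λ {c} c∈ → cong (_∧ (c <ᵇ b)) (<ᵇ-false (m≤a (there c∈)))) =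
  has32above-atMost a m (m≤a ∘ there)

has32above-++-atMost : ∀ a l m → AtMost a m → has32above a (l ++ m) ≡ has32above a l
has32above-++-atMost a [] m m≤a = has32above-atMost a m m≤a
has32above-++-atMost a (b ∷ l) m m≤a
  rewrite any-++ (between a b) l m
        | any-false (between a b) m (λ {c} c∈ → cong (_∧ (c <ᵇ b)) (<ᵇ-false (m≤a c∈)))
        | ∨-identityʳ (any (between a b) l) | has32above-++-atMost a l m m≤a = refl

contains132-++-separated : ∀ s l m → Above s l → AtMost s m →
  contains132 (l ++ m) ≡ contains132 l ∨ contains132 m
contains132-++-separated s [] m _ _ = refl
contains132-++-separated s (a ∷ l) m s<l m≤s
  rewrite has32above-++-atMost a l m (λ y∈ → ≤-trans (m≤s y∈) (<⇒≤ (s<l (here refl))))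
        | contains132-++-separated s l m (s<l ∘ there) m≤s = sym (∨-assoc (has32above a l) _ _)

has32above-∷ʳ-max : ∀ a l t → Below t l → has32above a (l ++ [ t ]) ≡ has32above a l
has32above-∷ʳ-max a [] t _ = refl
has32above-∷ʳ-max a (b ∷ l) t l<t
  rewrite any-++ (between a b) l [ t ] | <ᵇ-false {t} {b} (<⇒≤ (l<t (here refl))) | ∧-zeroʳ (a <ᵇ t)
        | ∨-identityʳ (any (between a b) l) | has32above-∷ʳ-max a l t (l<t ∘ there) = refl

contains132-∷ʳ-max : ∀ l t → Below t l → contains132 (l ++ [ t ]) ≡ contains132 l
contains132-∷ʳ-max [] t _ = refl
contains132-∷ʳ-max (a ∷ l) t l<t
  rewrite has32above-∷ʳ-max a l t (l<t ∘ there) | contains132-∷ʳ-max l t (l<t ∘ there) = refl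

contains132-∷-max : ∀ t l → AtMost t l → contains132 (t ∷ l) ≡ contains132 l
contains132-∷-max t l l≤t rewrite has32above-atMost t l l≤t = refl

any-between-raise : ∀ c a b l → any (between (c + a) (c + b)) (raise c l) ≡ any (between a b) l
any-between-raise c a b [] = refl
any-between-raise c a b (x ∷ l)
  rewrite +-cancelˡ-<ᵇ c a x | +-cancelˡ-<ᵇ c x b | any-between-raise c a b l = refl

has32above-raise : ∀ c a l → has32above (c + a) (raise c l) ≡ has32above a l
has32above-raise c a [] = refl
has32above-raise c a (b ∷ l) rewrite any-between-raise c a b l | has32above-raise c a l = refl

contains132-raise : ∀ c l → contains132 (raise c l) ≡ contains132 l
contains132-raise c [] = refl
contains132-raise c (a ∷ l) rewrite has32above-raise c a l | contains132-raise c l = refl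

has32above-++ˡ : ∀ a l m → has32above a l ≡ true → has32above a (l ++ m) ≡ true
has32above-++ˡ a (b ∷ l) m h rewrite any-++ (between a b) l m with any (between a b) l
... | true = refl
... | false rewrite has32above-++ˡ a l m h = ∨-zeroʳ _

contains132-++ˡ : ∀ l m → contains132 l ≡ true → contains132 (l ++ m) ≡ true
contains132-++ˡ (a ∷ l) m c with has32above a l in h
... | true rewrite has32above-++ˡ a l m h = refl
... | false rewrite contains132-++ˡ l m c = ∨-zeroʳ _

contains132-++ʳ : ∀ l m → contains132 m ≡ true → contains132 (l ++ m) ≡ true
contains132-++ʳ [] m c = c
contains132-++ʳ (a ∷ l) m c rewrite contains132-++ʳ l m c = ∨-zeroʳ _

avoids132-++⁻ˡ : ∀ l m → contains132 (l ++ m) ≡ false → contains132 l ≡ false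
avoids132-++⁻ˡ l m av with contains132 l in c
... | false = refl
... | true = ⊥-elim (true≢false (trans (sym (contains132-++ˡ l m c)) av))

avoids132-++⁻ʳ : ∀ l m → contains132 (l ++ m) ≡ false → contains132 m ≡ false
avoids132-++⁻ʳ l m av with contains132 m in c
... | false = refl
... | true = ⊥-elim (true≢false (trans (sym (contains132-++ʳ l m c)) av))

has32above-witness : ∀ a l n β {b} → b ∈ β → a < b → b < n → has32above a (l ++ n ∷ β) ≡ true
has32above-witness a [] n β b∈ a<b b<n
  rewrite any-true (between a n) β b∈ (cong₂ _∧_ (<ᵇ-true a<b) (<ᵇ-true b<n)) = refl
has32above-witness a (c ∷ l) n β b∈ a<b b<n rewrite has32above-witness a l n β b∈ a<b b<n = ∨-zeroʳ _

contains132-witness : ∀ α n β {a b} → a ∈ α → b ∈ β → a < b → b < n →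
  contains132 (α ++ n ∷ β) ≡ true
contains132-witness (a ∷ α) n β (here refl) b∈ a<b b<n
  rewrite has32above-witness a α n β b∈ a<b b<n = refl
contains132-witness (a ∷ α) n β (there a∈) b∈ a<b b<n
  rewrite contains132-witness α n β a∈ b∈ a<b b<n = ∨-zeroʳ _

filter-≤-range : ∀ M N → M ≤ N → filter (_≤? M) (range N) ≡ range M
filter-≤-range M zero z≤n = refl
filter-≤-range M (suc N) M≤N with M ≟ suc N
... | yes refl = filter-all (_≤? M) (All.tabulate (λ y∈ → proj₂ (∈-range⁻ y∈)))
... | no M≢N =
  trans (filter-reject (_≤? M) (λ N≤M → M≢N (≤-antisym M≤N N≤M))) (filter-≤-range M N (≤-pred (≤∧≢⇒< M≤N M≢N)))

filter->-range : ∀ M N → M ≤ N → filter (M <?_) (range N) ≡ raise M (range (N ∸ M))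
filter->-range M N M≤N = begin
  filter (M <?_) (range N)                               ≡⟨ cong (filter (M <?_) ∘ range) (sym (m∸n+n≡m M≤N)) ⟩
  filter (M <?_) (range ((N ∸ M) + M))                   ≡⟨ cong (filter (M <?_)) (range-+ (N ∸ M) M) ⟩
  filter (M <?_) (upper ++ range M)                      ≡⟨ filter-++ (M <?_) upper (range M) ⟩
  filter (M <?_) upper ++ filter (M <?_) (range M)
    ≡⟨ cong₂ _++_ (filter-all (M <?_) (All.tabulate (Above-raise M ↭-refl)))
                  (filter-none (M <?_) (All.tabulate (λ y∈ M<y → <⇒≱ M<y (proj₂ (∈-range⁻ y∈))))) ⟩
  upper ++ []                                            ≡⟨ ++-identityʳ upper ⟩
  upper                                                  ∎
  where
  open ≡-Reasoning
  upper = raise M (range (N ∸ M))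

-- Filtering by ≤ max β shows that the lower block β is {1, …, max β}.
separated-↭-range : ∀ N α β → α ++ β ↭ range N → (∀ {a b} → a ∈ α → b ∈ β → b < a) →
  ∃ λ M → (N ≡ M + length β) × (β ↭ range (length β)) × (α ↭ raise (length β) (range M))
separated-↭-range N α β αβ↭ β<α =
  N ∸ K , N≡ , subst (λ z → β ↭ range z) (sym |β|≡K) β↭ ,
  subst (λ z → α ↭ raise z (range (N ∸ K))) (sym |β|≡K) α↭
  where
  K = max 0 β
  ∈range : ∀ {x} → x ∈ α ++ β → 1 ≤ x × x ≤ N
  ∈range x∈ = ∈-range⁻ (Perm.∈-resp-↭ αβ↭ x∈)
  β≤K : ∀ {b} → b ∈ β → b ≤ K
  β≤K = All.lookup (xs≤max 0 β)
  K<α : ∀ {a} → a ∈ α → K < a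
  K<α a∈ = max<v⁺ (proj₁ (∈range (∈-++⁺ˡ a∈))) (All.tabulate (β<α a∈))
  K≤N : K ≤ N
  K≤N = max≤v⁺ z≤n (All.tabulate (λ b∈ → proj₂ (∈range (∈-++⁺ʳ α b∈))))
  β↭ : β ↭ range K
  β↭ = subst₂ _↭_
    (trans (filter-++ (_≤? K) α β)
           (cong₂ _++_ (filter-none (_≤? K) (All.tabulate (λ a∈ → <⇒≱ (K<α a∈))))
                       (filter-all (_≤? K) (All.tabulate β≤K))))
    (filter-≤-range K N K≤N) (Perm.filter-↭ (_≤? K) αβ↭)
  α↭ : α ↭ raise K (range (N ∸ K))
  α↭ = subst₂ _↭_
    (trans (filter-++ (K <?_) α β)
           (trans (cong₂ _++_ (filter-all (K <?_) (All.tabulate K<α))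
                              (filter-none (K <?_) (All.tabulate (λ b∈ → ≤⇒≯ (β≤K b∈)))))
                  (++-identityʳ α)))
    (filter->-range K N K≤N) (Perm.filter-↭ (K <?_) αβ↭)
  |β|≡K : length β ≡ K
  |β|≡K = trans (Perm.↭-length β↭) (length-range K)
  N≡ : N ≡ (N ∸ K) + length β
  N≡ = trans (sym (m∸n+n≡m K≤N)) (cong ((N ∸ K) +_) (sym |β|≡K))

unraise : ∀ K M α → α ↭ raise K (range M) → ∃ λ α₀ → (α ≡ raise K α₀) × (α₀ ↭ range M)
unraise K M α α↭ =
  map (_∸ K) α , sym (reraise α K≤α) , subst (map (_∸ K) α ↭_) (map-∸-raise K (range M)) (Perm.map⁺ (_∸ K) α↭)
  where
  K≤α : ∀ {a} → a ∈ α → K ≤ a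
  K≤α a∈ with ∈-map⁻ (K +_) (Perm.∈-resp-↭ α↭ a∈)
  ... | z , _ , refl = m≤m+n K z
  reraise : ∀ α → (∀ {a} → a ∈ α → K ≤ a) → raise K (map (_∸ K) α) ≡ α
  reraise [] _ = refl
  reraise (a ∷ α) K≤α = cong₂ _∷_ (m+[n∸m]≡n (K≤α (here refl))) (reraise α (K≤α ∘ there))

record MaxSplit (N : ℕ) (π : List ℕ) : Set where
  constructor maxSplit
  field
    M K : ℕ
    α β : List ℕ
    split : π ≡ raise K α ++ suc N ∷ β
    size : N ≡ M + K
    α↭ : α ↭ range M
    β↭ : β ↭ range K

avoids132-separated : ∀ N α β → α ++ suc N ∷ β ↭ range (suc N) →
  contains132 (α ++ suc N ∷ β) ≡ false → α ++ β ↭ range N × (∀ {a b} → a ∈ α → b ∈ β → b < a)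
avoids132-separated N α β π↭ avoid = αβ↭ , β<α
  where
  αβ↭ : α ++ β ↭ range N
  αβ↭ = drop-max-↭ α β π↭
  β<α : ∀ {a b} → a ∈ α → b ∈ β → b < a
  β<α {a} {b} a∈ b∈ with b <? a
  ... | yes b<a = b<a
  ... | no b≮a = ⊥-elim (true≢false (trans (sym (contains132-witness α (suc N) β a∈ b∈ a<b b<N)) avoid))
    where
    a≢b : a ≢ b
    a≢b = Unique-++-disjoint (Unique-resp-↭ (↭-sym αβ↭) (Unique-range N)) a∈ b∈
    a<b : a < b
    a<b = ≤∧≢⇒< (≮⇒≥ b≮a) a≢b
    b<N : b < suc N
    b<N = s≤s (proj₂ (∈-range⁻ (Perm.∈-resp-↭ αβ↭ (∈-++⁺ʳ α b∈))))

avoids132⇒maxSplit : ∀ N π → π ↭ range (suc N) → contains132 π ≡ false → MaxSplit N π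
avoids132⇒maxSplit N π π↭ avoid with ∈-∃++ (Perm.∈-resp-↭ (↭-sym π↭) (here refl))
... | α′ , β , refl with avoids132-separated N α′ β π↭ avoid
...   | α′β↭ , β<α′ with separated-↭-range N α′ β α′β↭ β<α′
...     | M , N≡ , β↭ , α′↭ with unraise (length β) M α′ α′↭
...       | α , refl , α↭ = maxSplit M (length β) α β refl N≡ α↭ β↭

-- An odd maximum cannot be followed by a larger entry, so it comes last.
odd-max-last : ∀ j {π} → isEven j ≡ true → IsD (suc j) π → ∃ λ γ → π ≡ γ ++ [ suc j ] × IsD j γ
odd-max-last j ev (isD π↭ dum avoid) with ∈-∃++ (Perm.∈-resp-↭ (↭-sym π↭) (here refl))
... | α , [] , refl = α , refl , isD α↭ dumα (avoids132-++⁻ˡ α [ suc j ] avoid)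
  where
  α↭ : α ↭ range j
  α↭ = subst (_↭ range j) (++-identityʳ α) (drop-max-↭ α [] π↭)
  dumα : isDumont α ≡ true
  dumα = trans (sym (isDumontBefore-high α (suc j) (Below-range α↭))) (proj₁ (isDumont-++⁻ α (suc j) [] dum))
... | α , b ∷ β , refl =
  ⊥-elim (true≢false (trans (sym (proj₁ (∧-true⁻ (proj₂ (isDumont-++⁻ α (suc j) (b ∷ β) dum))))) step))
  where
  b≤j : b ≤ j
  b≤j = proj₂ (∈-range⁻ (Perm.∈-resp-↭ (drop-max-↭ α (b ∷ β) π↭) (∈-++⁺ʳ α (here refl))))
  step : dumontStep (suc j) b ≡ false
  step = dumontStep-odd-≤ (even⇒odd-suc {j} ev) (m≤n⇒m≤1+n b≤j)

IsD-∷ʳ-max : ∀ j {γ} → isEven j ≡ true → IsD j γ → IsD (suc j) (γ ++ [ suc j ])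
IsD-∷ʳ-max j {γ} ev (isD γ↭ dum avoid) = isD (∷ʳ-↭-range γ↭) dum′ avoid′
  where
  dum′ : isDumont (γ ++ [ suc j ]) ≡ true
  dum′ = trans (isDumont-++ γ (suc j) [])
               (cong₂ _∧_ (trans (isDumontBefore-high γ (suc j) (Below-range γ↭)) dum)
                          (cong not (even⇒odd-suc {j} ev)))
  avoid′ : contains132 (γ ++ [ suc j ]) ≡ false
  avoid′ = trans (contains132-∷ʳ-max γ (suc j) (Below-range γ↭)) avoid

finalBlock : ℕ → List ℕ → List ℕ
finalBlock j α = suc (suc j) ∷ α ++ [ suc j ]

innerBlock : ℕ → List ℕ → List ℕ
innerBlock j γ = γ ++ suc j ∷ suc (suc j) ∷ []

raise-innerBlock : ∀ K j γ β → raise K (γ ++ [ suc j ]) ++ K + suc (suc j) ∷ β ≡ raise K (innerBlock j γ) ++ β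
raise-innerBlock K j γ β = begin
  raise K γ′ ++ K + suc (suc j) ∷ β            ≡⟨ sym (++-assoc (raise K γ′) [ K + suc (suc j) ] β) ⟩
  (raise K γ′ ++ [ K + suc (suc j) ]) ++ β     ≡⟨ cong (_++ β) (sym (map-++ (K +_) γ′ [ suc (suc j) ])) ⟩
  raise K (γ′ ++ [ suc (suc j) ]) ++ β         ≡⟨ cong (λ z → raise K z ++ β) (++-assoc γ [ suc j ] [ suc (suc j) ]) ⟩
  raise K (innerBlock j γ) ++ β                ∎
  where
  open ≡-Reasoning
  γ′ = γ ++ [ suc j ]

-- A run of inner blocks is always followed by smaller entries, for which 0 stands in.
record IsRun (m : ℕ) (g : List ℕ) : Set where
  constructor isRun
  field
    perm : g ↭ range m
    dumont : isDumontBefore g 0 ≡ true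
    avoids : contains132 g ≡ false
    even : isEven m ≡ true

RunWeight : ℕ → List ℕ → Mono → Set
RunWeight m g w = IsRun m g × (g ++ [ 0 ]) HasWeight w

FinalWeight : ℕ → List ℕ → Mono → Set
FinalWeight i p w = IsD i p × isEven i ≡ true × (∃ λ r → p ≡ i ∷ r) × p HasWeight w

EvenWeight : ℕ → List ℕ → Mono → Set
EvenWeight n π w = IsD n π × isEven n ≡ true × π HasWeight w

finalBlock-weight : ∀ j {α} → isEven j ≡ true → IsD j α →
  FinalWeight (suc (suc j)) (finalBlock j α) (addM [ 1 ] (σ₁ (weight α)))
finalBlock-weight j {α} ev α∈D@(isD α↭ _ _) =
  isD (prep (suc (suc j)) (IsD.perm α′∈D)) dum avoid , ev2 , (α ++ [ suc j ] , refl) ,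
  hasWeight-∷-max α′<t (hasWeight-∷ʳ-max (Below-range α↭) (weight-hasWeight α))
  where
  α′∈D = IsD-∷ʳ-max j ev α∈D
  ev2 : isEven (suc (suc j)) ≡ true
  ev2 = trans (isEven-2+ j) ev
  α′<t : Below (suc (suc j)) (α ++ [ suc j ])
  α′<t = Below-range (IsD.perm α′∈D)
  dum : isDumont (finalBlock j α) ≡ true
  dum = trans (isDumont-++ (suc (suc j) ∷ α) (suc j) [])
    (cong₂ _∧_ (cong₂ _∧_ (dumontStep-even ev2 (headOr-below α (suc j) (m<n⇒m<1+n ∘ Below-range α↭) ≤-refl))
                          (trans (isDumontBefore-high α (suc j) (Below-range α↭)) (IsD.dumont α∈D)))
               (cong not (even⇒odd-suc {j} ev)))
  avoid : contains132 (finalBlock j α) ≡ false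
  avoid = trans (contains132-∷-max (suc (suc j)) (α ++ [ suc j ]) (<⇒≤ ∘ α′<t)) (IsD.avoids α′∈D)

innerBlock-weight : ∀ j {γ} → isEven j ≡ true → IsD j γ →
  RunWeight (suc (suc j)) (innerBlock j γ) (addM [ 1 ] (σ₂ (weight γ)))
innerBlock-weight j {γ} ev (isD γ↭ dum avoid) = isRun perm dum′ avoid′ (trans (isEven-2+ j) ev) , weight′
  where
  γ′ = γ ++ [ suc j ]
  γ<j+1 : Below (suc j) γ
  γ<j+1 = Below-range γ↭
  γ′<j+2 : Below (suc (suc j)) γ′
  γ′<j+2 = Below-range (∷ʳ-↭-range γ↭)
  perm : innerBlock j γ ↭ range (suc (suc j))
  perm = ↭-trans (Perm.++-comm γ (suc j ∷ suc (suc j) ∷ [])) (swap (suc j) (suc (suc j)) γ↭)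
  dum′ : isDumontBefore (innerBlock j γ) 0 ≡ true
  dum′ = trans (isDumontBefore-++ γ (suc j ∷ suc (suc j) ∷ []) 0)
    (cong₂ _∧_ (trans (isDumontBefore-high γ (suc j) γ<j+1) dum)
               (cong₂ _∧_ (dumontStep-odd {suc j} (even⇒odd-suc {j} ev) ≤-refl)
                          (cong (_∧ true) (dumontStep-even {suc (suc j)} (trans (isEven-2+ j) ev) (s≤s z≤n)))))
  avoid′ : contains132 (innerBlock j γ) ≡ false
  avoid′ = trans (cong contains132 (sym (++-assoc γ [ suc j ] [ suc (suc j) ])))
    (trans (contains132-∷ʳ-max γ′ (suc (suc j)) γ′<j+2) (trans (contains132-∷ʳ-max γ (suc j) γ<j+1) avoid))
  twice-raised : (γ′ ++ [ suc (suc j) ]) HasWeight σ₁ (σ₁ (weight γ))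
  twice-raised = hasWeight-∷ʳ-max γ′<j+2 (hasWeight-∷ʳ-max γ<j+1 (weight-hasWeight γ))
  weight′ : (innerBlock j γ ++ [ 0 ]) HasWeight addM [ 1 ] (σ₂ (weight γ))
  weight′ = subst (_HasWeight _) reassociate (hasWeight-cong σ₁σ₁≈σ₂ (hasWeight-∷ʳ-0 {l = γ′} (s≤s z≤n) twice-raised))
    where
    reassociate : γ′ ++ suc (suc j) ∷ 0 ∷ [] ≡ innerBlock j γ ++ [ 0 ]
    reassociate = trans (++-assoc γ [ suc j ] (suc (suc j) ∷ 0 ∷ []))
                        (sym (++-assoc γ (suc j ∷ suc (suc j) ∷ []) [ 0 ]))
    σ₁σ₁≈σ₂ : ∀ k → exponent (addM [ 1 ] (σ₁ (σ₁ (weight γ)))) k ≡ exponent (addM [ 1 ] (σ₂ (weight γ))) k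
    σ₁σ₁≈σ₂ k = trans (exponent-addM [ 1 ] (σ₁ (σ₁ (weight γ))) k)
      (trans (cong (exponent [ 1 ] k +_) (sym (exponent-σ₂ (weight γ) k)))
             (sym (exponent-addM [ 1 ] (σ₂ (weight γ)) k)))

glue-runs : ∀ {i m c g u v} → i ≤ m → RunWeight i c u → RunWeight (m ∸ i) g v →
  RunWeight m (raise (m ∸ i) c ++ g) (addM u v)
glue-runs {i} {m} {c} {g} {u} {v} i≤m (isRun c↭ c-dum c-avoid c-even , c∶u)
                                      (isRun g↭ g-dum g-avoid g-even , g∶v) =
  isRun perm dum avoid even , weight′
  where
  s = m ∸ i
  i+s≡m : i + s ≡ m
  i+s≡m = m+[n∸m]≡n i≤m
  perm : raise s c ++ g ↭ range m
  perm = subst (λ z → raise s c ++ g ↭ range z) i+s≡m (raise-++-↭ c↭ g↭)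
  dum : isDumontBefore (raise s c ++ g) 0 ≡ true
  dum = trans (isDumontBefore-++ (raise s c) g 0)
    (cong₂ _∧_ (trans (isDumontBefore-low (raise s c) (headOr g 0) (s + 0)
                                          (Above-raise-headOr g c↭ (AtMost-range g↭)) (Above-+0 (Above-raise s c↭)))
                      (trans (isDumontBefore-raise s c 0 g-even) c-dum))
               g-dum)
  avoid : contains132 (raise s c ++ g) ≡ false
  avoid = trans (contains132-++-separated s (raise s c) g (Above-raise s c↭) (AtMost-range g↭))
                (cong₂ _∨_ (trans (contains132-raise s c) c-avoid) g-avoid)
  even : isEven m ≡ true
  even = subst (λ z → isEven z ≡ true) i+s≡m (trans (isEven-+ i s c-even) g-even)
  below : ∀ g → AtMost s g → (g ++ [ 0 ]) HasWeight v → (raise s c ++ g ++ [ 0 ]) HasWeight addM u v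
  below [] _ = hasWeight-raise-++ (Above-raise s c↭) (AtMost-∷ʳ-0 {l = []} (λ ())) c∶u
  below (y ∷ g) g≤s = hasWeight-raise-++ (Above-raise s c↭) (AtMost-∷ʳ-0 {l = y ∷ g} g≤s) c∶u
  weight′ : ((raise s c ++ g) ++ [ 0 ]) HasWeight addM u v
  weight′ = subst (_HasWeight addM u v) (sym (++-assoc (raise s c) g [ 0 ])) (below g (AtMost-range g↭) g∶v)

glue-final : ∀ {i n p g u v} → i ≤ n → FinalWeight i p u → RunWeight (n ∸ i) g v →
  EvenWeight n (raise i g ++ p) (addM u v)
glue-final {i} {n} {_} {g} {u} {v} i≤n (isD p↭ p-dum p-avoid , i-even , (r , refl) , p∶u)
                                       (isRun g↭ g-dum g-avoid g-even , g∶v) =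
  isD perm dum avoid , even ,
  hasWeight-cong addM-comm (hasWeight-raise-++ (Above-raise i g↭) (AtMost-range p↭) g∶v p∶u)
  where
  s = n ∸ i
  s+i≡n : s + i ≡ n
  s+i≡n = m∸n+n≡m i≤n
  perm : raise i g ++ i ∷ r ↭ range n
  perm = subst (λ z → raise i g ++ i ∷ r ↭ range z) s+i≡n (raise-++-↭ g↭ p↭)
  dum : isDumont (raise i g ++ i ∷ r) ≡ true
  dum = trans (isDumont-++ (raise i g) i r)
    (cong₂ _∧_ (trans (cong (isDumontBefore (raise i g)) (sym (+-identityʳ i)))
                      (trans (isDumontBefore-raise i g 0 i-even) g-dum))
               p-dum)
  avoid : contains132 (raise i g ++ i ∷ r) ≡ false
  avoid = trans (contains132-++-separated i (raise i g) (i ∷ r) (Above-raise i g↭) (AtMost-range p↭))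
                (cong₂ _∨_ (trans (contains132-raise i g) g-avoid) p-avoid)
  even : isEven n ≡ true
  even = subst (λ z → isEven z ≡ true) s+i≡n (trans (isEven-+ s i g-even) i-even)
  addM-comm : ∀ k → exponent (addM v u) k ≡ exponent (addM u v) k
  addM-comm k = trans (exponent-addM v u k) (trans (+-comm (exponent v k) _) (sym (exponent-addM u v k)))

Pointwise-∈ˡ : ∀ {A B : Set} {R : A → B → Set} {xs ys x} → Pointwise R xs ys → x ∈ xs →
  ∃ λ y → R x y
Pointwise-∈ˡ (r ∷ _) (here refl) = _ , r
Pointwise-∈ˡ (_ ∷ rs) (there x∈) = Pointwise-∈ˡ rs x∈

Pointwise-map : ∀ {A B C : Set} {R : B → C → Set} {f : A → B} {g : A → C} xs →
  (∀ {x} → x ∈ xs → R (f x) (g x)) → Pointwise R (map f xs) (map g xs)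
Pointwise-map [] _ = []
Pointwise-map (x ∷ xs) r = r (here refl) ∷ Pointwise-map xs (r ∘ there)

Pointwise-concatMap : ∀ {A B C D : Set} {R₀ : A → B → Set} {R : C → D → Set} {f : A → List C} {g : B → List D}
  {xs ys} → Pointwise R₀ xs ys → (∀ {x y} → R₀ x y → Pointwise R (f x) (g y)) →
  Pointwise R (concatMap f xs) (concatMap g ys)
Pointwise-concatMap [] _ = []
Pointwise-concatMap (r ∷ rs) h = Pointwise.++⁺ (h r) (Pointwise-concatMap rs h)

Pointwise-concatMap-∈ : ∀ {A C D : Set} {R : C → D → Set} {f : A → List C} {g : A → List D} xs →
  (∀ {x} → x ∈ xs → Pointwise R (f x) (g x)) → Pointwise R (concatMap f xs) (concatMap g xs)
Pointwise-concatMap-∈ [] _ = []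
Pointwise-concatMap-∈ (x ∷ xs) h = Pointwise.++⁺ (h (here refl)) (Pointwise-concatMap-∈ xs (h ∘ there))

-- The shape of the Cauchy product _⊗_, with an arbitrary way of joining the two factors.
convolution : ∀ {A B C : Set} → (ℕ → List A) → (ℕ → List B) → (ℕ → ℕ → A → B → C) → ℕ → List C
convolution X Y join n =
  concatMap (λ i → concatMap (λ x → map (join i (n ∸ i) x) (Y (n ∸ i))) (X i)) (upTo (suc n))

module _ {A B C : Set} {X : ℕ → List A} {Y : ℕ → List B} {join : ℕ → ℕ → A → B → C} where

  ∈-convolution⁺ : ∀ {n i j x y} → i + j ≡ n → x ∈ X i → y ∈ Y j → join i j x y ∈ convolution X Y join n
  ∈-convolution⁺ {n} {i} {j} {x} {y} refl x∈ y∈ =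
    subst (λ z → join i z x y ∈ convolution X Y join n) (m+n∸m≡n i j)
      (∈-concatMap⁺ (λ i → concatMap (λ x → map (join i (n ∸ i) x) (Y (n ∸ i))) (X i))
        (Any.map (λ { refl → ∈-concatMap⁺ (λ x → map (join i (n ∸ i) x) (Y (n ∸ i)))
                               (Any.map (λ { refl → ∈-map⁺ (join i (n ∸ i) x) y∈′ }) x∈) })
                 (∈-upTo⁺ (s≤s (m≤m+n i j)))))
    where
    y∈′ : y ∈ Y (n ∸ i)
    y∈′ = subst (λ z → y ∈ Y z) (sym (m+n∸m≡n i j)) y∈

  ∈-convolution⁻ : ∀ {n z} → z ∈ convolution X Y join n →
    ∃ λ i → ∃ λ x → ∃ λ y → i ≤ n × x ∈ X i × y ∈ Y (n ∸ i) × z ≡ join i (n ∸ i) x y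
  ∈-convolution⁻ {n} z∈
    with find (∈-concatMap⁻ (λ i → concatMap (λ x → map (join i (n ∸ i) x) (Y (n ∸ i))) (X i)) {xs = upTo (suc n)} z∈)
  ... | i , i∈ , z∈i with find (∈-concatMap⁻ (λ x → map (join i (n ∸ i) x) (Y (n ∸ i))) {xs = X i} z∈i)
  ...   | x , x∈ , z∈x with ∈-map⁻ (join i (n ∸ i) x) z∈x
  ...     | y , y∈ , z≡ = i , x , y , ≤-pred (∈-upTo⁻ i∈) , x∈ , y∈ , z≡

  Unique-convolution : ∀ n → (∀ i → Unique (X i)) → (∀ j → Unique (Y j)) →
    (∀ {i j x y y′} → join i j x y ≡ join i j x y′ → y ≡ y′) →
    (keyI : C → ℕ) (keyX : ℕ → C → A) →
    (∀ {i x y} → i ≤ n → x ∈ X i → y ∈ Y (n ∸ i) →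
       keyI (join i (n ∸ i) x y) ≡ i × keyX i (join i (n ∸ i) x y) ≡ x) →
    Unique (convolution X Y join n)
  Unique-convolution n X! Y! join-injective keyI keyX key =
    Unique-concatMap _ keyI (Unique.upTo⁺ (suc n))
      (λ {i} i∈ → Unique-concatMap _ (keyX i) (X! i) (λ _ → Unique.map⁺ join-injective (Y! (n ∸ i)))
        (λ {x} x∈ z∈ → case-key i∈ x∈ z∈ proj₂))
      (λ {i} i∈ z∈ → case-i i∈ z∈)
    where
    case-key : ∀ {i x z} {P : Set} → i ∈ upTo (suc n) → x ∈ X i → z ∈ map (join i (n ∸ i) x) (Y (n ∸ i)) →
      (keyI z ≡ i × keyX i z ≡ x → P) → P
    case-key i∈ x∈ z∈ k with ∈-map⁻ _ z∈
    ... | y , y∈ , refl = k (key (≤-pred (∈-upTo⁻ i∈)) x∈ y∈)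
    case-i : ∀ {i z} → i ∈ upTo (suc n) → z ∈ concatMap (λ x → map (join i (n ∸ i) x) (Y (n ∸ i))) (X i) →
      keyI z ≡ i
    case-i {i} i∈ z∈ with find (∈-concatMap⁻ (λ x → map (join i (n ∸ i) x) (Y (n ∸ i))) {xs = X i} z∈)
    ... | x , x∈ , z∈x = case-key i∈ x∈ z∈x proj₁

  Pointwise-convolution : ∀ {R : ℕ → A → Mono → Set} {R′ : ℕ → B → Mono → Set} {R″ : ℕ → C → Mono → Set}
    {S T : Series} →
    (∀ i → Pointwise (R i) (X i) (S i)) → (∀ j → Pointwise (R′ j) (Y j) (T j)) →
    (∀ {n i x y u v} → i ≤ n → R i x u → R′ (n ∸ i) y v → R″ n (join i (n ∸ i) x y) (addM u v)) →
    ∀ n → Pointwise (R″ n) (convolution X Y join n) ((S ⊗ T) n)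
  Pointwise-convolution X~S Y~T glue n = Pointwise-concatMap-∈ (upTo (suc n)) λ {i} i∈ →
    Pointwise-concatMap (X~S i) λ x~u →
      Pointwise.map⁺ _ _ (Pointwise.map (glue (≤-pred (∈-upTo⁻ i∈)) x~u) (Y~T (n ∸ i)))

evenDumontPerms : ℕ → List (List ℕ)
evenDumontPerms j = if isEven j then dumontPerms j else []

A3≡map-weight : ∀ j → A3 j ≡ map weight (evenDumontPerms j)
A3≡map-weight j with isEven j
... | true = refl
... | false = refl

∈-evenDumontPerms⁻ : ∀ j {α} → α ∈ evenDumontPerms j → isEven j ≡ true × IsD j α
∈-evenDumontPerms⁻ j α∈ with isEven j in ev
... | true = refl , ∈-dumontPerms⁻ j α∈

∈-evenDumontPerms⁺ : ∀ j {α} → isEven j ≡ true → IsD j α → α ∈ evenDumontPerms j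
∈-evenDumontPerms⁺ j ev α∈D rewrite ev = ∈-dumontPerms⁺ j α∈D

Unique-evenDumontPerms : ∀ j → Unique (evenDumontPerms j)
Unique-evenDumontPerms j with isEven j
... | true = Unique-dumontPerms j
... | false = []

finalBlocks : ℕ → List (List ℕ)
finalBlocks (suc (suc j)) = map (finalBlock j) (evenDumontPerms j)
finalBlocks _ = []

innerBlocks : ℕ → List (List ℕ)
innerBlocks (suc (suc j)) = map (innerBlock j) (evenDumontPerms j)
innerBlocks _ = []

innerOnRun : ℕ → ℕ → List ℕ → List ℕ → List ℕ
innerOnRun i j c g = raise j c ++ g

runOnFinal : ℕ → ℕ → List ℕ → List ℕ → List ℕ
runOnFinal i j p g = raise i g ++ p

-- Runs of k inner blocks of total size m, each block raised above the ones after it.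
runs : ℕ → ℕ → List (List ℕ)
runs zero zero = [] ∷ []
runs zero (suc m) = []
runs (suc k) = convolution innerBlocks (runs k) innerOnRun

allRuns : ℕ → List (List ℕ)
allRuns m = concatMap (λ k → runs k m) (upTo (suc m))

-- A run raised above a final block: the shape of every even-length member of 𝒟.
blockPerms : ℕ → List (List ℕ)
blockPerms = convolution finalBlocks allRuns runOnFinal

P : Series
P = mulX1²X2 (substS σ₁ A3)

Q : Series
Q = mulX1²X2 (substS σ₂ A3)

map-weight-∘ : ∀ (f g : Mono → Mono) xs → map (f ∘ g ∘ weight) xs ≡ map f (map g (map weight xs))
map-weight-∘ f g xs = trans (map-∘ xs) (cong (map f) (map-∘ xs))

finalBlocks~P : ∀ i → Pointwise (FinalWeight i) (finalBlocks i) (P i)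
finalBlocks~P zero = []
finalBlocks~P (suc zero) = []
finalBlocks~P (suc (suc j)) rewrite A3≡map-weight j =
  subst (Pointwise _ _) (map-weight-∘ (addM [ 1 ]) σ₁ (evenDumontPerms j))
    (Pointwise-map (evenDumontPerms j) λ α∈ →
      let ev , α∈D = ∈-evenDumontPerms⁻ j α∈ in finalBlock-weight j ev α∈D)

innerBlocks~Q : ∀ i → Pointwise (RunWeight i) (innerBlocks i) (Q i)
innerBlocks~Q zero = []
innerBlocks~Q (suc zero) = []
innerBlocks~Q (suc (suc j)) rewrite A3≡map-weight j =
  subst (Pointwise _ _) (map-weight-∘ (addM [ 1 ]) σ₂ (evenDumontPerms j))
    (Pointwise-map (evenDumontPerms j) λ γ∈ →
      let ev , γ∈D = ∈-evenDumontPerms⁻ j γ∈ in innerBlock-weight j ev γ∈D)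

runs~powS : ∀ k m → Pointwise (RunWeight m) (runs k m) (powS Q k m)
runs~powS zero zero = (isRun ↭-refl refl refl refl , weighs (λ _ → refl)) ∷ []
runs~powS zero (suc m) = []
runs~powS (suc k) = Pointwise-convolution {join = innerOnRun} innerBlocks~Q (runs~powS k) glue-runs

allRuns~geomS : ∀ m → Pointwise (RunWeight m) (allRuns m) (geomS Q m)
allRuns~geomS m = Pointwise-concatMap-∈ (upTo (suc m)) (λ {k} _ → runs~powS k m)

blockPerms~P⊗geomS : ∀ n → Pointwise (EvenWeight n) (blockPerms n) ((P ⊗ geomS Q) n)
blockPerms~P⊗geomS = Pointwise-convolution {join = runOnFinal} finalBlocks~P allRuns~geomS glue-final

∈-innerBlocks⇒IsRun : ∀ {i c} → c ∈ innerBlocks i → IsRun i c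
∈-innerBlocks⇒IsRun {i} c∈ = proj₁ (proj₂ (Pointwise-∈ˡ (innerBlocks~Q i) c∈))

∈-runs⇒IsRun : ∀ {k m g} → g ∈ runs k m → IsRun m g
∈-runs⇒IsRun {k} {m} g∈ = proj₁ (proj₂ (Pointwise-∈ˡ (runs~powS k m) g∈))

∈-allRuns⇒IsRun : ∀ {m g} → g ∈ allRuns m → IsRun m g
∈-allRuns⇒IsRun {m} g∈ = proj₁ (proj₂ (Pointwise-∈ˡ (allRuns~geomS m) g∈))

∈-blockPerms⇒IsD : ∀ {n π} → π ∈ blockPerms n → IsD n π
∈-blockPerms⇒IsD {n} π∈ = proj₁ (proj₂ (Pointwise-∈ˡ (blockPerms~P⊗geomS n) π∈))

∈-allRuns⁺ : ∀ {m k g} → k ≤ m → g ∈ runs k m → g ∈ allRuns m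
∈-allRuns⁺ {m} k≤m g∈ =
  ∈-concatMap⁺ (λ k → runs k m) (Any.map (λ { refl → g∈ }) (∈-upTo⁺ (s≤s k≤m)))

∈-allRuns⁻ : ∀ {m g} → g ∈ allRuns m → ∃ λ k → k ≤ m × g ∈ runs k m
∈-allRuns⁻ {m} g∈ with find (∈-concatMap⁻ (λ k → runs k m) {xs = upTo (suc m)} g∈)
... | k , k∈ , g∈k = k , ≤-pred (∈-upTo⁻ k∈) , g∈k

position : ℕ → List ℕ → ℕ
position m [] = 0
position m (a ∷ l) with a ≟ m
... | yes _ = 0
... | no _ = suc (position m l)

position-++ : ∀ m l r → Below m l → position m (l ++ m ∷ r) ≡ length l
position-++ m [] r _ with m ≟ m
... | yes _ = refl
... | no m≢m = ⊥-elim (m≢m refl)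
position-++ m (a ∷ l) r l<m with a ≟ m
... | yes refl = ⊥-elim (<-irrefl refl (l<m (here refl)))
... | no _ = cong suc (position-++ m l r (l<m ∘ there))

Unique-finalBlocks : ∀ i → Unique (finalBlocks i)
Unique-finalBlocks (suc (suc j)) =
  Unique.map⁺ (λ {x} {y} eq → ++-cancelʳ [ suc j ] x y (∷-injectiveʳ eq)) (Unique-evenDumontPerms j)
Unique-finalBlocks zero = []
Unique-finalBlocks (suc zero) = []

Unique-innerBlocks : ∀ i → Unique (innerBlocks i)
Unique-innerBlocks (suc (suc j)) =
  Unique.map⁺ (λ {x} {y} eq → ++-cancelʳ (suc j ∷ suc (suc j) ∷ []) x y eq) (Unique-evenDumontPerms j)
Unique-innerBlocks zero = []
Unique-innerBlocks (suc zero) = []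

∈-innerBlocks⁻ : ∀ {i c} → c ∈ innerBlocks i →
  ∃ λ j → ∃ λ γ → i ≡ suc (suc j) × c ≡ innerBlock j γ × IsD j γ
∈-innerBlocks⁻ {suc (suc j)} c∈ with ∈-map⁻ (innerBlock j) c∈
... | γ , γ∈ , refl = j , γ , refl , refl , proj₂ (∈-evenDumontPerms⁻ j γ∈)

∈-finalBlocks⁻ : ∀ {i p} → p ∈ finalBlocks i → ∃ λ j → ∃ λ α → i ≡ suc (suc j) × p ≡ finalBlock j α
∈-finalBlocks⁻ {suc (suc j)} p∈ with ∈-map⁻ (finalBlock j) p∈
... | α , _ , refl = j , α , refl , refl

-- The maximum m of a run sits at the end of its top block.
position-innerOnRun : ∀ {m i c} g → i ≤ m → c ∈ innerBlocks i →
  suc (position m (innerOnRun i (m ∸ i) c g)) ≡ i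
position-innerOnRun {m} {i} g i≤m c∈ with ∈-innerBlocks⁻ {i} c∈
... | j , γ , refl , refl , isD γ↭ _ _ = cong suc (begin
  position m (raise s (innerBlock j γ) ++ g)          ≡⟨ cong (position m) split ⟩
  position m (raise s (γ ++ [ suc j ]) ++ m ∷ g)      ≡⟨ position-++ m _ g below ⟩
  length (raise s (γ ++ [ suc j ]))                   ≡⟨ length-raise s (∷ʳ-↭-range γ↭) ⟩
  suc j                                               ∎)
  where
  open ≡-Reasoning
  s = m ∸ suc (suc j)
  s+top≡m : s + suc (suc j) ≡ m
  s+top≡m = m∸n+n≡m i≤m
  split : raise s (innerBlock j γ) ++ g ≡ raise s (γ ++ [ suc j ]) ++ m ∷ g
  split = trans (sym (raise-innerBlock s j γ g)) (cong (λ z → raise s (γ ++ [ suc j ]) ++ z ∷ g) s+top≡m)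
  below : Below m (raise s (γ ++ [ suc j ]))
  below y∈ with ∈-map⁻ (s +_) y∈
  ... | z , z∈ , refl = subst (s + z <_) s+top≡m (+-monoʳ-< s (Below-range (∷ʳ-↭-range γ↭) z∈))

Unique-runs : ∀ k m → Unique (runs k m)
Unique-runs zero zero = [] ∷ []
Unique-runs zero (suc m) = []
Unique-runs (suc k) m =
  Unique-convolution m Unique-innerBlocks (Unique-runs k) (λ {_ j x} → ++-cancelˡ (raise j x) _ _)
    (λ z → suc (position m z)) (λ i z → map (_∸ (m ∸ i)) (take i z)) key
  where
  key : ∀ {i c g} → i ≤ m → c ∈ innerBlocks i → g ∈ runs k (m ∸ i) →
    suc (position m (innerOnRun i (m ∸ i) c g)) ≡ i × map (_∸ (m ∸ i)) (take i (innerOnRun i (m ∸ i) c g)) ≡ c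
  key {i} {c} {g} i≤m c∈ _ = position-innerOnRun g i≤m c∈ ,
    trans (cong (λ z → map (_∸ (m ∸ i)) (take z (raise (m ∸ i) c ++ g))) (sym |c|≡i))
          (trans (cong (map (_∸ (m ∸ i))) (take-length-++ (raise (m ∸ i) c) g)) (map-∸-raise (m ∸ i) c))
    where
    |c|≡i : length (raise (m ∸ i) c) ≡ i
    |c|≡i = length-raise (m ∸ i) (IsRun.perm (∈-innerBlocks⇒IsRun c∈))

rightToLeftMaxima : List ℕ → ℕ
rightToLeftMaxima [] = 0
rightToLeftMaxima (a ∷ l) = (if all (_<ᵇ a) l then 1 else 0) + rightToLeftMaxima l

all-<ᵇ : ∀ a m → Below a m → all (_<ᵇ a) m ≡ true
all-<ᵇ a [] _ = refl
all-<ᵇ a (b ∷ m) m<a rewrite <ᵇ-true (m<a (here refl)) = all-<ᵇ a m (m<a ∘ there)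

rightToLeftMaxima-++ : ∀ s l m → Above s l → AtMost s m →
  rightToLeftMaxima (l ++ m) ≡ rightToLeftMaxima l + rightToLeftMaxima m
rightToLeftMaxima-++ s [] m _ _ = refl
rightToLeftMaxima-++ s (a ∷ l) m s<l m≤s
  rewrite all-++ (_<ᵇ a) l m | all-<ᵇ a m (λ y∈ → ≤-<-trans (m≤s y∈) (s<l (here refl)))
        | ∧-identityʳ (all (_<ᵇ a) l) =
  trans (cong ((if all (_<ᵇ a) l then 1 else 0) +_) (rightToLeftMaxima-++ s l m (s<l ∘ there) m≤s))
        (sym (+-assoc (if all (_<ᵇ a) l then 1 else 0) (rightToLeftMaxima l) (rightToLeftMaxima m)))

all-<ᵇ-raise : ∀ c a l → all (_<ᵇ c + a) (raise c l) ≡ all (_<ᵇ a) l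
all-<ᵇ-raise c a [] = refl
all-<ᵇ-raise c a (b ∷ l) rewrite +-cancelˡ-<ᵇ c b a | all-<ᵇ-raise c a l = refl

rightToLeftMaxima-raise : ∀ c l → rightToLeftMaxima (raise c l) ≡ rightToLeftMaxima l
rightToLeftMaxima-raise c [] = refl
rightToLeftMaxima-raise c (a ∷ l) rewrite all-<ᵇ-raise c a l | rightToLeftMaxima-raise c l = refl

rightToLeftMaxima-innerBlock : ∀ j γ → Below (suc j) γ → rightToLeftMaxima (innerBlock j γ) ≡ 1
rightToLeftMaxima-innerBlock j [] _ rewrite <ᵇ-false {suc (suc j)} {suc j} (n≤1+n _) = refl
rightToLeftMaxima-innerBlock j (a ∷ γ) γ<j+1
  rewrite all-++ (_<ᵇ a) γ (suc j ∷ suc (suc j) ∷ [])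
        | <ᵇ-false {suc (suc j)} {a} (≤-trans (<⇒≤ (γ<j+1 (here refl))) (n≤1+n _))
        | ∧-zeroʳ (suc j <ᵇ a) | ∧-zeroʳ (all (_<ᵇ a) γ) = rightToLeftMaxima-innerBlock j γ (γ<j+1 ∘ there)

rightToLeftMaxima-runs : ∀ k m {g} → g ∈ runs k m → rightToLeftMaxima g ≡ k
rightToLeftMaxima-runs zero zero (here refl) = refl
rightToLeftMaxima-runs (suc k) m g∈
  with ∈-convolution⁻ {X = innerBlocks} {Y = runs k} {join = innerOnRun} {n = m} g∈
... | i , c , g′ , _ , c∈ , g′∈ , refl with ∈-innerBlocks⁻ {i} c∈
...   | j , γ , refl , refl , isD γ↭ _ _ =
  trans (rightToLeftMaxima-++ s (raise s c) g′ (Above-raise s (IsRun.perm (∈-innerBlocks⇒IsRun c∈)))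
                                               (AtMost-range (IsRun.perm (∈-runs⇒IsRun {k} g′∈))))
        (cong₂ _+_ (trans (rightToLeftMaxima-raise s c) (rightToLeftMaxima-innerBlock j γ (Below-range γ↭)))
                   (rightToLeftMaxima-runs k s g′∈))
  where
  s = m ∸ suc (suc j)

-- Each inner block has exactly one right-to-left maximum, so a run determines its length.
Unique-allRuns : ∀ m → Unique (allRuns m)
Unique-allRuns m = Unique-concatMap (λ k → runs k m) rightToLeftMaxima (Unique.upTo⁺ (suc m))
  (λ {k} _ → Unique-runs k m) (λ {k} _ g∈ → rightToLeftMaxima-runs k m g∈)

Unique-blockPerms : ∀ n → Unique (blockPerms n)
Unique-blockPerms n = Unique-convolution n Unique-finalBlocks Unique-allRuns
  (λ {i _ x y y′} eq → raise-injective i (++-cancelʳ x (raise i y) (raise i y′) eq))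
  (λ z → suc (maybe′ id 0 (last z))) (λ i z → drop (n ∸ i) z) key
  where
  key : ∀ {i p g} → i ≤ n → p ∈ finalBlocks i → g ∈ allRuns (n ∸ i) →
    suc (maybe′ id 0 (last (runOnFinal i (n ∸ i) p g))) ≡ i × drop (n ∸ i) (runOnFinal i (n ∸ i) p g) ≡ p
  key {i} {p} {g} _ p∈ g∈ with ∈-finalBlocks⁻ {i} p∈
  ... | j , α , refl , refl = cong (suc ∘ maybe′ id 0) last≡ , dropped
    where
    last≡ : last (raise i g ++ finalBlock j α) ≡ just (suc j)
    last≡ = trans (cong last (sym (++-assoc (raise i g) (suc (suc j) ∷ α) [ suc j ])))
                  (last-∷ʳ (raise i g ++ suc (suc j) ∷ α) (suc j))
    |g|≡ : length (raise i g) ≡ n ∸ i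
    |g|≡ = length-raise i (IsRun.perm (∈-allRuns⇒IsRun {n ∸ i} g∈))
    dropped : drop (n ∸ i) (raise i g ++ finalBlock j α) ≡ finalBlock j α
    dropped = trans (cong (λ z → drop z (raise i g ++ finalBlock j α)) (sym |g|≡))
                    (drop-length-++ (raise i g) (finalBlock j α))

-- Every even-length member of 𝒟 is a run on a final block

finalBlock-∈-blockPerms : ∀ j {α} → isEven j ≡ true → IsD j α → finalBlock j α ∈ blockPerms (suc (suc j))
finalBlock-∈-blockPerms j ev α∈D =
  ∈-convolution⁺ {X = finalBlocks} {Y = allRuns} {join = runOnFinal} (+-identityʳ _)
    (∈-map⁺ (finalBlock j) (∈-evenDumontPerms⁺ j ev α∈D)) (here refl)

innerBlock-on-blockPerms : ∀ K j {γ β} → isEven j ≡ true → IsD j γ → β ∈ blockPerms K →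
  raise K (innerBlock j γ) ++ β ∈ blockPerms (K + suc (suc j))
innerBlock-on-blockPerms K j {γ} ev γ∈D β∈
  with ∈-convolution⁻ {X = finalBlocks} {Y = allRuns} {join = runOnFinal} {n = K} β∈
... | i , p , g , i≤K , p∈ , g∈ , refl with ∈-allRuns⁻ g∈
...   | k , k≤d , g∈k = subst (_∈ blockPerms (K + t)) (sym restack)
                          (∈-convolution⁺ {X = finalBlocks} {Y = allRuns} {join = runOnFinal} sizes p∈ g′∈)
  where
  t = suc (suc j)
  d = K ∸ i
  c = innerBlock j γ
  i+d≡K : i + d ≡ K
  i+d≡K = m+[n∸m]≡n i≤K
  sizes : i + (t + d) ≡ K + t
  sizes = trans (solve 3 (λ i t d → i :+ (t :+ d) := (i :+ d) :+ t) refl i t d) (cong (_+ t) i+d≡K)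
    where open +-*-Solver
  g′∈ : innerOnRun t d c g ∈ allRuns (t + d)
  g′∈ = ∈-allRuns⁺ {t + d} {suc k} (≤-trans (s≤s k≤d) (s≤s (m≤n+m d (suc j))))
          (∈-convolution⁺ {X = innerBlocks} {Y = runs k} {join = innerOnRun} {n = t + d} {i = t} {j = d} refl
                          (∈-map⁺ (innerBlock j) (∈-evenDumontPerms⁺ j ev γ∈D)) g∈k)
  restack : raise K c ++ raise i g ++ p ≡ raise i (raise d c ++ g) ++ p
  restack = begin
    raise K c ++ raise i g ++ p                ≡⟨ cong (λ z → raise z c ++ raise i g ++ p) (sym i+d≡K) ⟩
    raise (i + d) c ++ raise i g ++ p          ≡⟨ cong (_++ raise i g ++ p) (sym (raise-raise i d c)) ⟩
    raise i (raise d c) ++ raise i g ++ p      ≡⟨ sym (++-assoc (raise i (raise d c)) (raise i g) p) ⟩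
    (raise i (raise d c) ++ raise i g) ++ p    ≡⟨ cong (_++ p) (sym (map-++ (i +_) (raise d c) g)) ⟩
    raise i (raise d c ++ g) ++ p              ∎
    where open ≡-Reasoning

data EvenSplit (n : ℕ) : List ℕ → Set where
  final : ∀ {j α} → n ≡ suc (suc j) → isEven j ≡ true → IsD j α → EvenSplit n (finalBlock j α)
  inner : ∀ {K j γ β} → n ≡ suc K + suc (suc j) → isEven j ≡ true → IsD j γ →
          isEven (suc K) ≡ true → IsD (suc K) β → EvenSplit n (raise (suc K) (innerBlock j γ) ++ β)

even-max-not-last : ∀ N l → isEven (suc N) ≡ true → isDumont (l ++ [ suc N ]) ≡ true → ⊥
even-max-not-last N l ev dum = true≢false (trans (sym (proj₂ (isDumont-++⁻ l (suc N) [] dum))) (cong not ev))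

IsD-suffix : ∀ N {K l β} → β ↭ range K → IsD (suc N) (l ++ suc N ∷ β) → IsD K β
IsD-suffix N {K} {l} {[]} β↭ _ = isD β↭ refl refl
IsD-suffix N {K} {l} {b ∷ β} β↭ (isD _ dum avoid) =
  isD β↭ (isDumont-tail (suc N) b β (proj₂ (isDumont-++⁻ l (suc N) (b ∷ β) dum)))
         (avoids132-++⁻ʳ [ suc N ] (b ∷ β) (avoids132-++⁻ʳ l (suc N ∷ b ∷ β) avoid))

-- The least entry K + 1 of the raised block is followed by a larger entry, so it is odd.
raise-offset-even : ∀ K {j α t} → α ↭ range (suc j) → K < t → isDumontBefore (raise K α) t ≡ true →
  isEven K ≡ true
raise-offset-even K {j} {α} {t} α↭ K<t dum with isEven K in evK
... | true = refl
... | false with ∈-∃++ (∈-map⁺ (K +_) (Perm.∈-resp-↭ (↭-sym α↭) (∈-range⁺ {1} {suc j} (s≤s z≤n) (s≤s z≤n))))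
...   | u , v , split =
  ⊥-elim (<⇒≱ (even-followed-by-smaller u (K + 1) v t dum′ ev) (follower v (λ y∈ → K<α (∈-++⁺ʳ u (there y∈)))))
  where
  dum′ : isDumontBefore (u ++ K + 1 ∷ v) t ≡ true
  dum′ = subst (λ z → isDumontBefore z t ≡ true) split dum
  K<α : Above K (u ++ K + 1 ∷ v)
  K<α y∈ = Above-raise K α↭ (subst (_ ∈_) (sym split) y∈)
  ev : isEven (K + 1) ≡ true
  ev = trans (cong isEven (+-comm K 1)) (odd⇒even-suc {K} evK)
  follower : ∀ v → Above K v → K + 1 ≤ headOr v t
  follower [] _ = subst (_≤ t) (+-comm 1 K) K<t
  follower (y ∷ v) K<v = subst (_≤ y) (+-comm 1 K) (K<v (here refl))

IsD-raised-prefix : ∀ N {K M α β} → isEven K ≡ true → α ↭ range M → suc N ≡ K + suc M →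
  IsD (suc N) (raise K α ++ suc N ∷ β) → IsD M α
IsD-raised-prefix N {K} {M} {α} {β} ev α↭ size (isD _ dum avoid) = isD α↭ dumα
  (trans (sym (contains132-raise K α)) (avoids132-++⁻ˡ (raise K α) (suc N ∷ β) avoid))
  where
  dumα : isDumont α ≡ true
  dumα = begin
    isDumont α                                   ≡⟨ sym (isDumontBefore-high α (suc M) (Below-range α↭)) ⟩
    isDumontBefore α (suc M)                     ≡⟨ sym (isDumontBefore-raise K α (suc M) ev) ⟩
    isDumontBefore (raise K α) (K + suc M)       ≡⟨ cong (isDumontBefore (raise K α)) (sym size) ⟩
    isDumontBefore (raise K α) (suc N)           ≡⟨ proj₁ (isDumont-++⁻ (raise K α) (suc N) β dum) ⟩
    true                                         ∎
    where open ≡-Reasoning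


even-summand : ∀ K j → isEven (K + suc (suc j)) ≡ true → isEven K ≡ true → isEven j ≡ true
even-summand K j ev evK = trans (sym (isEven-2+ j)) (trans (sym (isEven-+ K (suc (suc j)) evK)) ev)

evenSplit-inner : ∀ j K {α β} → let N = suc j + suc K in isEven (suc N) ≡ true → isEven (suc K) ≡ true →
  α ↭ range (suc j) → β ↭ range (suc K) → IsD (suc N) (raise (suc K) α ++ suc N ∷ β) →
  EvenSplit (suc N) (raise (suc K) α ++ suc N ∷ β)
evenSplit-inner j K {β = β} ev evK α↭ β↭ π∈D
  with odd-max-last j (even-summand (suc K) j (trans (cong isEven (+-comm (suc K) (suc (suc j)))) ev) evK)
                      (IsD-raised-prefix _ evK α↭ (+-comm (suc (suc j)) (suc K)) π∈D)
... | γ , refl , γ∈D =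
  subst (EvenSplit _) (sym (trans (cong (λ z → raise (suc K) (γ ++ [ suc j ]) ++ z ∷ β) size)
                                  (raise-innerBlock (suc K) j γ β)))
        (inner size (even-summand (suc K) j (trans (cong isEven (sym size)) ev) evK) γ∈D evK (IsD-suffix _ β↭ π∈D))
  where
  size : suc (suc j + suc K) ≡ suc K + suc (suc j)
  size = +-comm (suc (suc j)) (suc K)

evenSplit-at-max : ∀ N M K {α β} → isEven (suc N) ≡ true → N ≡ M + K → α ↭ range M → β ↭ range K →
  IsD (suc N) (raise K α ++ suc N ∷ β) → EvenSplit (suc N) (raise K α ++ suc N ∷ β)
evenSplit-at-max N M zero {α} ev _ _ β↭ π∈D with Perm.↭-empty-inv β↭
... | refl = ⊥-elim (even-max-not-last N (raise 0 α) ev (IsD.dumont π∈D))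
evenSplit-at-max .(suc K) zero (suc K) ev refl α↭ β↭ π∈D with Perm.↭-empty-inv α↭
... | refl with odd-max-last K (trans (sym (isEven-2+ K)) ev) (IsD-suffix (suc K) {l = []} β↭ π∈D)
...   | γ , refl , γ∈D = final refl (trans (sym (isEven-2+ K)) ev) γ∈D
evenSplit-at-max .(suc j + suc K) (suc j) (suc K) {α} {β} ev refl α↭ β↭ π∈D =
  evenSplit-inner j K ev evK α↭ β↭ π∈D
  where
  evK : isEven (suc K) ≡ true
  evK = raise-offset-even (suc K) α↭ (s≤s (m≤n+m (suc K) (suc j)))
          (proj₁ (isDumont-++⁻ (raise (suc K) α) _ β (IsD.dumont π∈D)))

evenSplit : ∀ N {π} → isEven (suc N) ≡ true → IsD (suc N) π → EvenSplit (suc N) π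
evenSplit N ev π∈D with avoids132⇒maxSplit N _ (IsD.perm π∈D) (IsD.avoids π∈D)
... | maxSplit M K α β refl size α↭ β↭ = evenSplit-at-max N M K ev size α↭ β↭ π∈D

ListedIfEven : ℕ → Set
ListedIfEven N = ∀ {π} → isEven (suc N) ≡ true → IsD (suc N) π → π ∈ blockPerms (suc N)

IsD⇒∈-blockPerms : ∀ N → ListedIfEven N
IsD⇒∈-blockPerms = <-rec ListedIfEven step
  where
  step : ∀ N → (∀ {K} → K < N → ListedIfEven K) → ListedIfEven N
  step N rec ev π∈D with evenSplit N ev π∈D
  ... | final refl evj α∈D = finalBlock-∈-blockPerms _ evj α∈D
  ... | inner {K} {j} {γ} {β} size evj γ∈D evK β∈D =
    subst (λ n → raise (suc K) (innerBlock j γ) ++ β ∈ blockPerms n) (sym size)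
          (innerBlock-on-blockPerms (suc K) j evj γ∈D (rec K<N evK β∈D))
    where
    K<N : K < N
    K<N = subst (K <_) (sym (suc-injective size)) (m<m+n K (s≤s z≤n))

Pointwise-[]ʳ : ∀ {A B : Set} {R : A → B → Set} {xs ys} → (∀ {x y} → ¬ R x y) → Pointwise R xs ys →
  ys ≡ []
Pointwise-[]ʳ _ [] = refl
Pointwise-[]ʳ ¬R (r ∷ _) = ⊥-elim (¬R r)

map-norm-weight : ∀ {R : List ℕ → Mono → Set} {xs ys} → (∀ {π w} → R π w → π HasWeight w) →
  Pointwise R xs ys → map norm (map weight xs) ≡ map norm ys
map-norm-weight _ [] = refl
map-norm-weight hasWeight (r ∷ rs) = cong₂ _∷_ (norm-weight (hasWeight r)) (map-norm-weight hasWeight rs)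

dumontPerms↭blockPerms : ∀ N → isEven (suc N) ≡ true → dumontPerms (suc N) ↭ blockPerms (suc N)
dumontPerms↭blockPerms N ev = ↭-fromMembership (Unique-dumontPerms (suc N)) (Unique-blockPerms (suc N))
  (λ π∈ → IsD⇒∈-blockPerms N ev (∈-dumontPerms⁻ (suc N) π∈))
  (λ π∈ → ∈-dumontPerms⁺ (suc N) (∈-blockPerms⇒IsD π∈))

dumontPerms↭odd : ∀ j → isEven j ≡ true → dumontPerms (suc j) ↭ map (_++ [ suc j ]) (dumontPerms j)
dumontPerms↭odd j ev = ↭-fromMembership (Unique-dumontPerms (suc j))
  (Unique.map⁺ (λ {x} {y} → ++-cancelʳ [ suc j ] x y) (Unique-dumontPerms j)) to from
  where
  to : ∀ {π} → π ∈ dumontPerms (suc j) → π ∈ map (_++ [ suc j ]) (dumontPerms j)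
  to π∈ with odd-max-last j ev (∈-dumontPerms⁻ (suc j) π∈)
  ... | γ , refl , γ∈D = ∈-map⁺ (_++ [ suc j ]) (∈-dumontPerms⁺ j γ∈D)
  from : ∀ {π} → π ∈ map (_++ [ suc j ]) (dumontPerms j) → π ∈ dumontPerms (suc j)
  from π∈ with ∈-map⁻ (_++ [ suc j ]) π∈
  ... | γ , γ∈ , refl = ∈-dumontPerms⁺ (suc j) (IsD-∷ʳ-max j ev (∈-dumontPerms⁻ j γ∈))

P⊗geomS-odd : ∀ n → isEven n ≡ false → (P ⊗ geomS Q) n ≡ []
P⊗geomS-odd n odd = Pointwise-[]ʳ (λ (_ , even , _) → true≢false (trans (sym even) odd)) (blockPerms~P⊗geomS n)

append-max~σ₁ : ∀ j → Pointwise _HasWeight_ (map (_++ [ suc j ]) (dumontPerms j)) (map σ₁ (map weight (dumontPerms j)))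
append-max~σ₁ j = subst (Pointwise _HasWeight_ _) (map-∘ (dumontPerms j)) (Pointwise-map (dumontPerms j) λ γ∈ →
  hasWeight-∷ʳ-max (Below-range (IsD.perm (∈-dumontPerms⁻ j γ∈))) (weight-hasWeight _))

A3-recurrence : A3 ≈S (oneS ⊕ (P ⊗ geomS Q))
A3-recurrence zero = ↭-refl
A3-recurrence (suc N) with isEven (suc N) in ev
... | true = ↭-trans (Perm.map⁺ norm (Perm.map⁺ weight (dumontPerms↭blockPerms N ev)))
                     (↭-reflexive (map-norm-weight (proj₂ ∘ proj₂) (blockPerms~P⊗geomS (suc N))))
... | false rewrite P⊗geomS-odd (suc N) ev = ↭-refl

B3-recurrence : B3 ≈S mulX1 (substS σ₁ A3)
B3-recurrence zero = ↭-refl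
B3-recurrence (suc j) with isEven j in ev
... | true rewrite even⇒odd-suc {j} ev =
  ↭-trans (Perm.map⁺ norm (Perm.map⁺ weight (dumontPerms↭odd j ev)))
          (↭-reflexive (map-norm-weight id (append-max~σ₁ j)))
... | false rewrite odd⇒even-suc {j} ev = ↭-refl

theorem2p14 : (A3 ≈S (oneS ⊕ (mulX1²X2 (substS σ₁ A3) ⊗ geomS (mulX1²X2 (substS σ₂ A3)))))
    × (B3 ≈S mulX1 (substS σ₁ A3))
theorem2p14 = A3-recurrence , B3-recurrence
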